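{- Let $G$ be a $k$-graph, $v\in V(G)$ and $e=x_1\dots x_k\in E(G)$. Suppose that $e$ is $C$-reachable from $v$ and $C'$-rotatable. Let $T$ be a rooted $k$-loose tree at $r$ with $\Delta_1(T)\le \Delta$. Then there exists a homomorphism $\phi$ from $T$ to $G$ such that $\phi(r)=v$ and, for all $j\in[k]$, $|C_j(T)\setminus \phi^{ -1}(x_j)|\le (k\Delta)^{C+C'}$.
   Context: A $k$-graph is a hypergraph whose edges all have $k$ vertices. A $k$-loose tree is built iteratively: a single $k$-edge is one, and adding to a $k$-loose tree $T$ a new edge $e$ with $|e\cap V(T)|=1$ gives another. $\Delta_1(T)$ is the maximum vertex degree of $T$. A rooted $k$-loose tree at $r$ is a $k$-loose tree $T$ with a distinguished vertex $r$, together with a proper vertex colouring with colour classes $C_1(T),\dots,C_k(T)$ (no edge contains two vertices of the same colour) and a layering, i.e. a partition of $V(T)$ into layers $L_1,\dots,L_p$ with $L_1=\{r\}$, $C_i(T)=\bigcup_{j\equiv i \pmod k}L_j$, each edge is an $L_iL_{i+1}\dots L_{i+k-1}$-edge (one vertex in each of these layers) for some $i$, and each $v\in L_i$ lies in at most one edge that is not an $L_i\dots L_{i+k-1}$-edge; in particular $r\in C_1(T)$. For vertices $r,v$ of $T$, $\mathrm{dist}(r,v)$ denotes their distance in $T$ (number of edges of the unique loose path joining them; $0$ if $v=r$). A homomorphism from a $k$-graph $H_1$ to a $k$-graph $H_2$ is a map $\phi:V(H_1)\to V(H_2)$ with $\phi(f)\in E(H_2)$ for all $f\in E(H_1)$.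 An edge $e\in E(G)$ is $C$-reachable from a vertex $u$ if for every rooted $k$-loose tree $T$ at $r$ there is a homomorphism $\phi$ from $T$ to $G$ with $\phi(r)=u$ and $\phi(w)\in e$ for all $w$ with $\mathrm{dist}(r,w)>C$. An edge $e=u_1\dots u_k\in E(G)$ is $C$-rotatable if for every $u\in e$, every permutation $\sigma\in S_k$ and every rooted $k$-loose tree $T$ at $r$ there is a homomorphism $\phi$ from $T$ to $G$ with $\phi(r)=u$ and $\phi(w)=u_{\sigma(s)}$ for all $w\in C_s(T)$ with $\mathrm{dist}(r,w)\ge C$. -}

module Defs where

open import Data.Nat using (ℕ; zero; suc; _+_; _*_; _∸_; _^_; _≤_; _<_; _%_)
open import Data.Fin as Fin using (Fin; toℕ)
open import Data.Fin.Subset using (Subset; _∈_; _∩_; _∪_; ∣_∣)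
open import Data.Fin.Subset.Properties using (_∈?_)
open import Data.Fin.Permutation using (Permutation′; _⟨$⟩ʳ_)
open import Data.List using (List; []; _∷_; length; filter)
open import Data.List.Membership.Propositional renaming (_∈_ to _∈ᴸ_)
open import Data.List.Relation.Unary.Unique.Propositional using (Unique)
open import Data.List.Relation.Binary.Permutation.Propositional using (_↭_)
open import Data.Vec using (tabulate)
open import Data.Bool using (Bool; _∧_; not)
open import Data.Product using (Σ; ∃; _×_; _,_)
open import Data.Sum using (_⊎_)
open import Data.Unit using (⊤)
open import Data.Empty using (⊥)
open import Relation.Nullary using (¬_)
open import Relation.Nullary.Decidable using (⌊_⌋)
open import Relation.Binary.PropositionalEquality using (_≡_; _≢_)

record KGraph (k : ℕ) : Set where
  field
    n      : ℕ
    edges  : List (Subset n)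
    edgeSz : ∀ {e} → e ∈ᴸ edges → ∣ e ∣ ≡ k
    simple : Unique edges
open KGraph public

degree : ∀ {k} (H : KGraph k) → Fin (n H) → ℕ
degree H v = length (filter (v ∈?_) (edges H))

IsHom : ∀ {k} (H₁ H₂ : KGraph k) → (Fin (n H₁) → Fin (n H₂)) → Set
IsHom H₁ H₂ φ =
  ∀ {f} → f ∈ᴸ edges H₁ →
    ∃ λ g → g ∈ᴸ edges H₂ ×
      (∀ y → (y ∈ g → ∃ λ x → x ∈ f × φ x ≡ y) × ((∃ λ x → x ∈ f × φ x ≡ y) → y ∈ g))

LooseFrom : ∀ {m} → Subset m → List (Subset m) → Set
LooseFrom U []       = ⊤
LooseFrom U (e ∷ es) = ∣ e ∩ U ∣ ≡ 1 × LooseFrom (U ∪ e) es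

LooseOrder : ∀ {m} → List (Subset m) → Set
LooseOrder []       = ⊥
LooseOrder (e ∷ es) = LooseFrom e es

IsLooseTree : ∀ {k} → KGraph k → Set
IsLooseTree H =
  (∃ λ es → es ↭ edges H × LooseOrder es) ×
  (∀ v → ∃ λ e → e ∈ᴸ edges H × v ∈ e)

-- In a loose tree this is
-- the number of edges of the unique loose path joining u and w.

data Walk {k} (H : KGraph k) : Fin (n H) → Fin (n H) → ℕ → Set where
  single : ∀ {e u w} → e ∈ᴸ edges H → u ∈ e → w ∈ e → Walk H u w 1
  step   : ∀ {e u x w d} → e ∈ᴸ edges H → u ∈ e → x ∈ e →
           Walk H x w d → Walk H u w (suc d)

DistIs : ∀ {k} (H : KGraph k) → Fin (n H) → Fin (n H) → ℕ → Set
DistIs H u w d =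
  (d ≡ 0 × u ≡ w) ⊎
  (u ≢ w × Walk H u w d × (∀ d′ → d′ < d → ¬ Walk H u w d′))

-- Rooted k-loose trees.  Colours are Fin k (colour i ∈ Fin k stands for
-- colour class C_{i+1}); layers are positive naturals (layer j is L_j).

LayerEdge : ∀ {m} (k : ℕ) → (Fin m → ℕ) → Subset m → ℕ → Set
LayerEdge {m} k ℓ e i =
  ∀ (t : Fin k) → ∃ λ v → v ∈ e × ℓ v ≡ i + toℕ t ×
    (∀ w → w ∈ e → ℓ w ≡ i + toℕ t → w ≡ v)

record RootedLooseTree (k : ℕ) : Set where
  field
    tree      : KGraph k
    isTree    : IsLooseTree tree
    root      : Fin (n tree)
    colour    : Fin (n tree) → Fin k
    proper    : ∀ {e} → e ∈ᴸ edges tree → ∀ v w → v ∈ e → w ∈ e →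
                colour v ≡ colour w → v ≡ w
    layer     : Fin (n tree) → ℕ
    layer≥1   : ∀ v → 1 ≤ layer v
    L₁≡root   : ∀ v → layer v ≡ 1 → v ≡ root
    rootL₁    : layer root ≡ 1
    -- C_i = ⋃_{j ≡ i mod k} L_j : vertex of colour i+1 (i : Fin k) lies in
    -- a layer j with j ≡ i+1 (mod k)
    colLayer  : ∀ v → ∃ λ q → layer v ≡ suc (toℕ (colour v)) + q * k
    edgeLayer : ∀ {e} → e ∈ᴸ edges tree → ∃ λ i → LayerEdge k layer e i
    atMostOne : ∀ v {e e′} → e ∈ᴸ edges tree → e′ ∈ᴸ edges tree →
                v ∈ e → v ∈ e′ →
                ¬ LayerEdge k layer e (layer v) →
                ¬ LayerEdge k layer e′ (layer v) → e ≡ e′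
open RootedLooseTree public

-- Reachability and rotatability.  An edge e = u₁…u_k of G is given
-- as a subset e ∈ E(G) together with an enumeration u : Fin k → Fin n
-- (injective, with image e).

Enumerates : ∀ {k} (G : KGraph k) → Subset (n G) → (Fin k → Fin (n G)) → Set
Enumerates {k} G e u =
  (∀ i j → u i ≡ u j → i ≡ j) ×
  (∀ y → (y ∈ e → ∃ λ j → u j ≡ y) × ((∃ λ j → u j ≡ y) → y ∈ e))

Reachable : ∀ {k} (G : KGraph k) → ℕ → Fin (n G) → Subset (n G) → Set
Reachable {k} G C v e =
  ∀ (T : RootedLooseTree k) →
    ∃ λ (φ : Fin (n (tree T)) → Fin (n G)) →
      IsHom (tree T) G φ × φ (root T) ≡ v ×
      (∀ w d → DistIs (tree T) (root T) w d → C < d → φ w ∈ e)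

Rotatable : ∀ {k} (G : KGraph k) → ℕ → Subset (n G) → (Fin k → Fin (n G)) → Set
Rotatable {k} G C e u =
  ∀ y → y ∈ e → ∀ (σ : Permutation′ k) (T : RootedLooseTree k) →
    ∃ λ (φ : Fin (n (tree T)) → Fin (n G)) →
      IsHom (tree T) G φ × φ (root T) ≡ y ×
      (∀ w d → DistIs (tree T) (root T) w d → C ≤ d →
         φ w ≡ u (σ ⟨$⟩ʳ colour T w))

missCount : ∀ {k} (T : RootedLooseTree k) {N : ℕ} →
            (Fin (n (tree T)) → Fin N) → Fin k → (Fin k → Fin N) → ℕ
missCount T φ j x =
  ∣ tabulate (λ w → ⌊ colour T w Fin.≟ j ⌋ ∧ not ⌊ φ w Fin.≟ x j ⌋) ∣

-- A reachability homomorphism φ₀ already sends every vertex deeper than C into e.  For each vertex s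
-- at depth C + 1, reroot T at s and apply rotatability to φ₀ s, with the permutation matching the colour
-- classes of the rerooted tree to those of T: this maps every vertex of colour j at distance at least C′
-- below s to x_j.  Gluing φ₀ (down to depth C + 1) with these maps (on the subtrees of the vertices at
-- depth C + 1) gives a homomorphism that can miss x_j only inside the ball of radius C + C′ around the
-- root, which has at most (kΔ)^(C + C′) vertices.  The technical heart is the rerooting: lifting the
-- layers off the root–s path by multiples of k and re-layering the path edges cyclically keeps a valid
-- layering in which the colours have only been rotated.

module Submission where

open import Defs
open import Data.Bool using (Bool; true; _∧_; not)
open import Data.Empty using (⊥; ⊥-elim)
open import Data.Fin as Fin using (Fin; toℕ; fromℕ<)
open import Data.Fin.Permutation using (Permutation′; permutation; _⟨$⟩ʳ_)
open import Data.Fin.Properties as Finₚ using (toℕ-injective; toℕ<n; toℕ-fromℕ<; any?)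
open import Data.Fin.Subset as Subset using (Subset; _∈_; ∣_∣; _∪_; _∩_; _-_; ⁅_⁆; _⊆_; ⋃; inside; outside)
open import Data.Fin.Subset.Properties
open import Data.List using (List; []; _∷_; length; filter)
open import Data.List.Membership.Propositional using () renaming (_∈_ to _∈ᴸ_)
open import Data.List.Membership.Propositional.Properties using (∈-filter⁺; ∈-filter⁻)
open import Data.List.Relation.Binary.Permutation.Propositional using (↭-sym)
open import Data.List.Relation.Binary.Permutation.Propositional.Properties using (∈-resp-↭)
open import Data.List.Relation.Unary.Any using (here; there)
open import Data.Nat using (ℕ; zero; suc; _*_; _+_; _^_; _≤_; _<_; _∸_; z≤n; s≤s; _≤?_; _<?_; _%_; _/_)
open import Data.Nat.DivMod
open import Data.Nat.Properties
open import Data.Nat.Tactic.RingSolver using (solve-∀)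
open import Data.Product using (Σ; ∃; _×_; _,_; proj₁; proj₂)
open import Data.Sum using (_⊎_; inj₁; inj₂)
open import Data.Vec as Vec using (tabulate; []; _∷_)
open import Data.Vec.Properties using (lookup∘tabulate; []=⇒lookup; lookup⇒[]=)
open import Function using (_∘_; case_of_)
open import Relation.Binary.PropositionalEquality
open import Relation.Nullary using (¬_; Dec; yes; no)
open import Relation.Nullary.Decidable using (⌊_⌋; _×-dec_)

module Cyclic (k′ : ℕ) where

  k : ℕ
  k = suc k′

  residue : ℕ → Fin k
  residue x = fromℕ< (m%n<n x k)

  toℕ-residue : ∀ x → toℕ (residue x) ≡ x % k
  toℕ-residue x = toℕ-fromℕ< (m%n<n x k)

  %-absorbˡ : ∀ a b → (a % k + b) % k ≡ (a + b) % k
  %-absorbˡ a b = begin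
    (a % k + b) % k           ≡⟨ %-distribˡ-+ (a % k) b k ⟩
    (a % k % k + b % k) % k   ≡⟨ cong (λ z → (z + b % k) % k) (m%n%n≡m%n a k) ⟩
    (a % k + b % k) % k       ≡⟨ %-distribˡ-+ a b k ⟨
    (a + b) % k               ∎
    where open ≡-Reasoning

  complement : ℕ → ℕ
  complement a = k ∸ a % k

  +-complement : ∀ x a → (x + a + complement a) % k ≡ x % k
  +-complement x a = begin
    (x + a + (k ∸ b)) % k                 ≡⟨ cong (λ z → (x + z + (k ∸ b)) % k) (m≡m%n+[m/n]*n a k) ⟩
    (x + (b + a / k * k) + (k ∸ b)) % k   ≡⟨ cong (_% k) (reorder x b (a / k * k) (k ∸ b)) ⟩
    (x + (b + (k ∸ b)) + a / k * k) % k   ≡⟨ cong (λ z → (x + z + a / k * k) % k) (m+[n∸m]≡n (m%n≤n a k)) ⟩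
    (x + k + a / k * k) % k               ≡⟨ cong (_% k) (+-assoc x k (a / k * k)) ⟩
    (x + suc (a / k) * k) % k             ≡⟨ [m+kn]%n≡m%n x (suc (a / k)) k ⟩
    x % k                                 ∎
    where
    open ≡-Reasoning
    b = a % k
    reorder : ∀ x b c d → x + (b + c) + d ≡ x + (b + d) + c
    reorder = solve-∀

  +-%-injective : ∀ a {s t} → s < k → t < k → (a + s) % k ≡ (a + t) % k → s ≡ t
  +-%-injective a {s} {t} s<k t<k eq = begin
    s                                  ≡⟨ m<n⇒m%n≡m s<k ⟨
    s % k                              ≡⟨ +-complement s a ⟨
    (s + a + complement a) % k         ≡⟨ %-absorbˡ (s + a) _ ⟨
    ((s + a) % k + complement a) % k   ≡⟨ cong (λ z → (z % k + complement a) % k) (+-comm s a) ⟩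
    ((a + s) % k + complement a) % k   ≡⟨ cong (λ z → (z + complement a) % k) eq ⟩
    ((a + t) % k + complement a) % k   ≡⟨ cong (λ z → (z % k + complement a) % k) (+-comm a t) ⟩
    ((t + a) % k + complement a) % k   ≡⟨ %-absorbˡ (t + a) _ ⟩
    (t + a + complement a) % k         ≡⟨ +-complement t a ⟩
    t % k                              ≡⟨ m<n⇒m%n≡m t<k ⟩
    t                                  ∎
    where open ≡-Reasoning

  rotate : ℕ → Permutation′ k
  rotate a = permutation (shiftBy a) (shiftBy (complement a))
                         (shiftBy-cancel (complement a) a λ y → trans (cong (_% k) (swap y _ a)) (+-complement y a))
                         (shiftBy-cancel a (complement a) λ y → +-complement y a)
    where
    shiftBy : ℕ → Fin k → Fin k
    shiftBy b c = residue (toℕ c + b)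
    swap : ∀ y c a → y + c + a ≡ y + a + c
    swap = solve-∀
    shiftBy-cancel : ∀ c b → (∀ y → (y + c + b) % k ≡ y % k) → ∀ y → shiftBy b (shiftBy c y) ≡ y
    shiftBy-cancel c b cancel y = toℕ-injective (begin
      toℕ (residue (toℕ (residue (toℕ y + c)) + b)) ≡⟨ toℕ-residue (toℕ (residue (toℕ y + c)) + b) ⟩
      (toℕ (residue (toℕ y + c)) + b) % k           ≡⟨ cong (λ z → (z + b) % k) (toℕ-residue (toℕ y + c)) ⟩
      ((toℕ y + c) % k + b) % k                     ≡⟨ %-absorbˡ (toℕ y + c) b ⟩
      (toℕ y + c + b) % k                           ≡⟨ cancel (toℕ y) ⟩
      toℕ y % k                                     ≡⟨ m<n⇒m%n≡m (toℕ<n y) ⟩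
      toℕ y                                         ∎)
      where open ≡-Reasoning

  toℕ-rotate : ∀ a c → toℕ (rotate a ⟨$⟩ʳ c) ≡ (toℕ c + a) % k
  toℕ-rotate a c = toℕ-residue (toℕ c + a)

  -- (x − y) mod k, written with k′ * y ≡ −y (mod k) to avoid truncated subtraction.
  offset : ℕ → ℕ → ℕ
  offset y x = (x + k′ * y) % k

  offset-+ : ∀ i p q → offset (i + p) (i + q) ≡ (q + k′ * p) % k
  offset-+ i p q = trans (cong (_% k) (shift i q k′ p)) ([m+kn]%n≡m%n (q + k′ * p) i k)
    where
    shift : ∀ i q k′ p → i + q + k′ * (i + p) ≡ q + k′ * p + i * suc k′
    shift = solve-∀

  offset-≤ : ∀ {y x} → y ≤ x → x < y + k → offset y x ≡ x ∸ y
  offset-≤ {y} {x} y≤x x<y+k = begin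
    (x + k′ * y) % k            ≡⟨ cong (λ z → (z + k′ * y) % k) (m+[n∸m]≡n y≤x) ⟨
    (y + (x ∸ y) + k′ * y) % k  ≡⟨ cong (_% k) (shift y (x ∸ y) k′) ⟩
    (x ∸ y + y * k) % k         ≡⟨ [m+kn]%n≡m%n (x ∸ y) y k ⟩
    (x ∸ y) % k                 ≡⟨ m<n⇒m%n≡m x∸y<k ⟩
    x ∸ y                       ∎
    where
    open ≡-Reasoning
    shift : ∀ y d k′ → y + d + k′ * y ≡ d + y * suc k′
    shift = solve-∀
    x∸y<k : x ∸ y < k
    x∸y<k = +-cancelˡ-< y _ _ (subst (_< y + k) (sym (m+[n∸m]≡n y≤x)) x<y+k)

  offset-> : ∀ {y x} → x < y → y < x + k → offset y x ≡ x + k ∸ y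
  offset-> {y} {x} x<y y<x+k with m≤n⇒∃[o]m+o≡n x<y
  ... | d , refl = begin
    (x + k′ * suc (x + d)) % k   ≡⟨ cong (_% k) (subst (λ K → x + K * suc (x + d) ≡ e + (x + d) * suc K)
                                                       (sym k′≡d+e) (wrap x d e)) ⟩
    (e + (x + d) * k) % k        ≡⟨ [m+kn]%n≡m%n e (x + d) k ⟩
    e % k                        ≡⟨ m≤n⇒m%n≡m (m∸n≤m k′ d) ⟩
    e                            ≡⟨ [m+n]∸[m+o]≡n∸o x k (suc d) ⟨
    x + k ∸ (x + suc d)          ≡⟨ cong (x + k ∸_) (+-suc x d) ⟩
    x + k ∸ suc (x + d)          ∎
    where
    open ≡-Reasoning
    e = k′ ∸ d
    d<k′ : d < k′
    d<k′ = ≤-pred (+-cancelˡ-< x (suc d) k (subst (_< x + k) (sym (+-suc x d)) y<x+k))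
    k′≡d+e : k′ ≡ d + e
    k′≡d+e = sym (m+[n∸m]≡n (<⇒≤ d<k′))
    wrap : ∀ x d e → x + (d + e) * suc (x + d) ≡ e + (x + d) * suc (d + e)
    wrap = solve-∀

  residue-offset : ∀ {q} p → q < k → ((q + k′ * p) % k + p) % k ≡ q
  residue-offset {q} p q<k = begin
    ((q + k′ * p) % k + p) % k   ≡⟨ %-absorbˡ (q + k′ * p) p ⟩
    (q + k′ * p + p) % k         ≡⟨ cong (_% k) (gather q p k′) ⟩
    (q + p * k) % k              ≡⟨ [m+kn]%n≡m%n q p k ⟩
    q % k                        ≡⟨ m<n⇒m%n≡m q<k ⟩
    q                            ∎
    where
    open ≡-Reasoning
    gather : ∀ q p k′ → q + k′ * p + p ≡ q + p * suc k′
    gather = solve-∀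

  offset-residue : ∀ {t} p → t < k → ((t + p) % k + k′ * p) % k ≡ t
  offset-residue {t} p t<k = begin
    ((t + p) % k + k′ * p) % k   ≡⟨ %-absorbˡ (t + p) (k′ * p) ⟩
    (t + p + k′ * p) % k         ≡⟨ cong (_% k) (gather t p k′) ⟩
    (t + p * k) % k              ≡⟨ [m+kn]%n≡m%n t p k ⟩
    t % k                        ≡⟨ m<n⇒m%n≡m t<k ⟩
    t                            ∎
    where
    open ≡-Reasoning
    gather : ∀ t p k′ → t + p + k′ * p ≡ t + p * suc k′
    gather = solve-∀

  -- Colours are read off layers as ℓ ≡ 1 + c (mod k), so Y + ℓs ≡ ℓw (mod k) gives cw ≡ Y + cs.
  colour-shift : ∀ {Y ℓw ℓs cw cs qw qs H} → cw < k → Y + ℓs ≡ ℓw + k * H →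
                 ℓw ≡ suc cw + qw * k → ℓs ≡ suc cs + qs * k → (Y % k + cs) % k ≡ cw
  colour-shift {Y} {ℓw} {ℓs} {cw} {cs} {qw} {qs} {H} cw<k Y+ℓs≡ ℓw≡ ℓs≡ = begin
    (Y % k + cs) % k              ≡⟨ %-absorbˡ Y cs ⟩
    (Y + cs) % k                  ≡⟨ [m+kn]%n≡m%n (Y + cs) qs k ⟨
    (Y + cs + qs * k) % k         ≡⟨ cong (_% k) (suc-injective layers) ⟩
    (cw + (qw + H) * k) % k       ≡⟨ [m+kn]%n≡m%n cw (qw + H) k ⟩
    cw % k                        ≡⟨ m<n⇒m%n≡m cw<k ⟩
    cw                            ∎
    where
    open ≡-Reasoning
    into : ∀ Y cs qs k → suc (Y + cs + qs * k) ≡ Y + (suc cs + qs * k)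
    into = solve-∀
    out : ∀ cw qw k H → suc cw + qw * k + k * H ≡ suc (cw + (qw + H) * k)
    out = solve-∀
    layers : suc (Y + cs + qs * k) ≡ suc (cw + (qw + H) * k)
    layers = trans (into Y cs qs k) (trans (cong (Y +_) (sym ℓs≡))
               (trans Y+ℓs≡ (trans (cong (_+ k * H) ℓw≡) (out cw qw k H))))

injection⇒≤∣p∣ : ∀ {a m} (p : Subset m) (g : Fin a → Fin m) → (∀ i j → g i ≡ g j → i ≡ j) →
                 (∀ i → g i ∈ p) → a ≤ ∣ p ∣
injection⇒≤∣p∣ {zero}  p g inj mem = z≤n
injection⇒≤∣p∣ {suc a} p g inj mem = ≤-trans (s≤s (injection⇒≤∣p∣ (p - g Fin.zero) (g ∘ Fin.suc) inj′ mem′))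
                                              (x∈p⇒∣p-x∣<∣p∣ (mem Fin.zero))
  where
  inj′ : ∀ i j → g (Fin.suc i) ≡ g (Fin.suc j) → i ≡ j
  inj′ i j eq = Finₚ.suc-injective (inj _ _ eq)
  mem′ : ∀ i → g (Fin.suc i) ∈ p - g Fin.zero
  mem′ i = x∈p∧x≢y⇒x∈p-y (mem (Fin.suc i)) (λ eq → case inj _ _ eq of λ ())

∣p∪q∣≤∣p∣+∣q∣ : ∀ {m} (p q : Subset m) → ∣ p ∪ q ∣ ≤ ∣ p ∣ + ∣ q ∣
∣p∪q∣≤∣p∣+∣q∣ []            []            = z≤n
∣p∪q∣≤∣p∣+∣q∣ (outside ∷ p) (outside ∷ q) = ∣p∪q∣≤∣p∣+∣q∣ p q
∣p∪q∣≤∣p∣+∣q∣ (outside ∷ p) (inside ∷ q)  = ≤-trans (s≤s (∣p∪q∣≤∣p∣+∣q∣ p q)) (≤-reflexive (sym (+-suc ∣ p ∣ ∣ q ∣)))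
∣p∪q∣≤∣p∣+∣q∣ (inside ∷ p)  (outside ∷ q) = s≤s (∣p∪q∣≤∣p∣+∣q∣ p q)
∣p∪q∣≤∣p∣+∣q∣ (inside ∷ p)  (inside ∷ q)  = s≤s (≤-trans (∣p∪q∣≤∣p∣+∣q∣ p q) (+-monoʳ-≤ ∣ p ∣ (n≤1+n ∣ q ∣)))

x∈⋃⁺ : ∀ {m} {ps : List (Subset m)} {p x} → p ∈ᴸ ps → x ∈ p → x ∈ ⋃ ps
x∈⋃⁺ (here refl) x∈p = x∈p∪q⁺ (inj₁ x∈p)
x∈⋃⁺ (there p∈)  x∈p = x∈p∪q⁺ (inj₂ (x∈⋃⁺ p∈ x∈p))

∣⋃∣≤ : ∀ {m} c (ps : List (Subset m)) → (∀ {p} → p ∈ᴸ ps → ∣ p ∣ ≡ c) → ∣ ⋃ ps ∣ ≤ c * length ps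
∣⋃∣≤ {m} c []       _  = ≤-reflexive (trans (∣⊥∣≡0 m) (sym (*-zeroʳ c)))
∣⋃∣≤     c (p ∷ ps) sz = begin
  ∣ p ∪ ⋃ ps ∣           ≤⟨ ∣p∪q∣≤∣p∣+∣q∣ p (⋃ ps) ⟩
  ∣ p ∣ + ∣ ⋃ ps ∣       ≤⟨ +-mono-≤ (≤-reflexive (sz (here refl))) (∣⋃∣≤ c ps (sz ∘ there)) ⟩
  c + c * length ps     ≡⟨ *-suc c (length ps) ⟨
  c * suc (length ps)   ∎
  where open ≤-Reasoning

⋃ᶠ : ∀ {a m} → Subset a → (Fin a → Subset m) → Subset m
⋃ᶠ []            F = Subset.⊥
⋃ᶠ (inside ∷ p)  F = F Fin.zero ∪ ⋃ᶠ p (F ∘ Fin.suc)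
⋃ᶠ (outside ∷ p) F = ⋃ᶠ p (F ∘ Fin.suc)

x∈⋃ᶠ⁺ : ∀ {a m} (p : Subset a) (F : Fin a → Subset m) {i x} → i ∈ p → x ∈ F i → x ∈ ⋃ᶠ p F
x∈⋃ᶠ⁺ (inside ∷ p)  F Vec.here        x∈ = x∈p∪q⁺ (inj₁ x∈)
x∈⋃ᶠ⁺ (inside ∷ p)  F (Vec.there i∈) x∈ = x∈p∪q⁺ (inj₂ (x∈⋃ᶠ⁺ p (F ∘ Fin.suc) i∈ x∈))
x∈⋃ᶠ⁺ (outside ∷ p) F (Vec.there i∈) x∈ = x∈⋃ᶠ⁺ p (F ∘ Fin.suc) i∈ x∈

∣⋃ᶠ∣≤ : ∀ {a m} (p : Subset a) (F : Fin a → Subset m) c → (∀ i → i ∈ p → ∣ F i ∣ ≤ c) → ∣ ⋃ᶠ p F ∣ ≤ c * ∣ p ∣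
∣⋃ᶠ∣≤ {m = m} []    F c _  = ≤-reflexive (trans (∣⊥∣≡0 m) (sym (*-zeroʳ c)))
∣⋃ᶠ∣≤ (outside ∷ p) F c sz = ∣⋃ᶠ∣≤ p (F ∘ Fin.suc) c (λ i i∈ → sz (Fin.suc i) (Vec.there i∈))
∣⋃ᶠ∣≤ (inside ∷ p)  F c sz = begin
  ∣ F Fin.zero ∪ ⋃ᶠ p (F ∘ Fin.suc) ∣          ≤⟨ ∣p∪q∣≤∣p∣+∣q∣ (F Fin.zero) _ ⟩
  ∣ F Fin.zero ∣ + ∣ ⋃ᶠ p (F ∘ Fin.suc) ∣       ≤⟨ +-mono-≤ (sz Fin.zero Vec.here)
                                                   (∣⋃ᶠ∣≤ p (F ∘ Fin.suc) c (λ i i∈ → sz (Fin.suc i) (Vec.there i∈))) ⟩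
  c + c * ∣ p ∣                                ≡⟨ *-suc c ∣ p ∣ ⟨
  c * suc ∣ p ∣                                ∎
  where open ≤-Reasoning

neighbourhood : ∀ {m} → List (Subset m) → Fin m → Subset m
neighbourhood es t = ⋃ (filter (t ∈?_) es)

∈-neighbourhood : ∀ {m} (es : List (Subset m)) {e t u} → e ∈ᴸ es → t ∈ e → u ∈ e → u ∈ neighbourhood es t
∈-neighbourhood es {t = t} e∈ t∈ u∈ = x∈⋃⁺ (∈-filter⁺ (t ∈?_) e∈ t∈) u∈

∣neighbourhood∣≤ : ∀ {m} c (es : List (Subset m)) → (∀ {e} → e ∈ᴸ es → ∣ e ∣ ≡ c) →
                   ∀ t → ∣ neighbourhood es t ∣ ≤ c * length (filter (t ∈?_) es)
∣neighbourhood∣≤ c es sz t = ∣⋃∣≤ c (filter (t ∈?_) es) (λ e∈ → sz (proj₁ (∈-filter⁻ (t ∈?_) e∈)))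

∈-tabulate⁺ : ∀ {m} (g : Fin m → Bool) {u} → g u ≡ true → u ∈ tabulate g
∈-tabulate⁺ g {u} gu = lookup⇒[]= u (tabulate g) (trans (lookup∘tabulate g u) gu)

∈-tabulate⁻ : ∀ {m} (g : Fin m → Bool) {u} → u ∈ tabulate g → g u ≡ true
∈-tabulate⁻ g {u} u∈ = trans (sym (lookup∘tabulate g u)) ([]=⇒lookup u∈)

isYes⇒ : ∀ {P : Set} (d : Dec P) → ⌊ d ⌋ ≡ true → P
isYes⇒ (yes p) _ = p

⇒isYes : ∀ {P : Set} (d : Dec P) → P → ⌊ d ⌋ ≡ true
⇒isYes (yes _) _ = refl
⇒isYes (no ¬p) p = ⊥-elim (¬p p)

module Layered {m : ℕ} (k′ : ℕ) (ℓ : Fin m → ℕ) where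
  open Cyclic k′

  module Edge {f i} (∣f∣≡k : ∣ f ∣ ≡ k) (f-at-i : LayerEdge k ℓ f i) where

    vertex : Fin k → Fin m
    vertex t = proj₁ (f-at-i t)

    vertex∈ : ∀ t → vertex t ∈ f
    vertex∈ t = proj₁ (proj₂ (f-at-i t))

    layer-vertex : ∀ t → ℓ (vertex t) ≡ i + toℕ t
    layer-vertex t = proj₁ (proj₂ (proj₂ (f-at-i t)))

    vertex-unique : ∀ t {w} → w ∈ f → ℓ w ≡ i + toℕ t → w ≡ vertex t
    vertex-unique t {w} = proj₂ (proj₂ (proj₂ (f-at-i t))) w

    -- Otherwise v and the k vertices (vertex t) would be k + 1 distinct elements of f.
    layer-offset : ∀ {v} → v ∈ f → ∃ λ (t : Fin k) → ℓ v ≡ i + toℕ t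
    layer-offset {v} v∈ with any? (λ t → ℓ v ≟ i + toℕ t)
    ... | yes found = found
    ... | no ¬found = ⊥-elim (<-irrefl refl (≤-trans (injection⇒≤∣p∣ f g g-injective g∈) (≤-reflexive ∣f∣≡k)))
      where
      g : Fin (suc k) → Fin m
      g Fin.zero    = v
      g (Fin.suc t) = vertex t
      g-injective : ∀ a b → g a ≡ g b → a ≡ b
      g-injective Fin.zero    Fin.zero    _  = refl
      g-injective Fin.zero    (Fin.suc b) eq = ⊥-elim (¬found (b , trans (cong ℓ eq) (layer-vertex b)))
      g-injective (Fin.suc a) Fin.zero    eq = ⊥-elim (¬found (a , trans (cong ℓ (sym eq)) (layer-vertex a)))
      g-injective (Fin.suc a) (Fin.suc b) eq = cong Fin.suc (toℕ-injective (+-cancelˡ-≡ i _ _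
        (trans (sym (layer-vertex a)) (trans (cong ℓ eq) (layer-vertex b)))))
      g∈ : ∀ a → g a ∈ f
      g∈ Fin.zero    = v∈
      g∈ (Fin.suc t) = vertex∈ t

    layer-injective : ∀ {v w} → v ∈ f → w ∈ f → ℓ v ≡ ℓ w → v ≡ w
    layer-injective {v} {w} v∈ w∈ eq with layer-offset v∈
    ... | t , ℓv≡ = trans (vertex-unique t v∈ ℓv≡) (sym (vertex-unique t w∈ (trans (sym eq) ℓv≡)))

    start≤layer : ∀ {v} → v ∈ f → i ≤ ℓ v
    start≤layer v∈ with layer-offset v∈
    ... | t , ℓv≡ = ≤-trans (m≤m+n _ _) (≤-reflexive (sym ℓv≡))

    layer<start+k : ∀ {v} → v ∈ f → ℓ v < i + k
    layer<start+k v∈ with layer-offset v∈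
    ... | t , ℓv≡ = ≤-trans (≤-reflexive (cong suc ℓv≡))
                      (≤-trans (≤-reflexive (sym (+-suc i (toℕ t)))) (+-monoʳ-≤ i (toℕ<n t)))

    offset-positive : ∀ {a v} → a ∈ f → v ∈ f → v ≢ a → 1 ≤ offset (ℓ a) (ℓ v)
    offset-positive {a} {v} a∈ v∈ v≢a with ℓ a ≤? ℓ v
    ... | yes a≤v = ≤-trans (m<n⇒0<n∸m (≤∧≢⇒< a≤v (λ eq → v≢a (layer-injective v∈ a∈ (sym eq)))))
                            (≤-reflexive (sym (offset-≤ a≤v v<a+k)))
      where v<a+k = ≤-trans (layer<start+k v∈) (+-monoˡ-≤ k (start≤layer a∈))
    ... | no a≰v = ≤-trans (m<n⇒0<n∸m a<v+k) (≤-reflexive (sym (offset-> (≰⇒> a≰v) a<v+k)))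
      where a<v+k = ≤-trans (layer<start+k a∈) (+-monoˡ-≤ k (start≤layer v∈))

    start≤ : ∀ {j} → LayerEdge k ℓ f j → i ≤ j
    start≤ {j} f-at-j with f-at-j Fin.zero
    ... | w , w∈ , ℓw≡ , _ = ≤-trans (start≤layer w∈) (≤-reflexive (trans ℓw≡ (+-identityʳ j)))

    relayer : ∀ {a} → a ∈ f → (X : Fin m → ℕ) (B : ℕ) →
              (∀ v → v ∈ f → X v ≡ B + offset (ℓ a) (ℓ v)) → LayerEdge k X f B
    relayer {a} a∈ X B X≡ t = w , vertex∈ q , Xw , unique
      where
      p = toℕ (proj₁ (layer-offset a∈))
      ℓa≡ : ℓ a ≡ i + p
      ℓa≡ = proj₂ (layer-offset a∈)
      X≡offset : ∀ {v} → v ∈ f → (s : Fin k) → ℓ v ≡ i + toℕ s → X v ≡ B + (toℕ s + k′ * p) % k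
      X≡offset v∈ s ℓv≡ = trans (X≡ _ v∈) (cong (B +_) (trans (cong₂ offset ℓa≡ ℓv≡) (offset-+ i p (toℕ s))))
      q = residue (toℕ t + p)
      w = vertex q
      Xw : X w ≡ B + toℕ t
      Xw = trans (X≡offset (vertex∈ q) q (layer-vertex q)) (cong (B +_) (begin
        (toℕ q + k′ * p) % k               ≡⟨ cong (λ z → (z + k′ * p) % k) (toℕ-residue (toℕ t + p)) ⟩
        ((toℕ t + p) % k + k′ * p) % k     ≡⟨ offset-residue p (toℕ<n t) ⟩
        toℕ t                              ∎))
        where open ≡-Reasoning
      unique : ∀ w′ → w′ ∈ f → X w′ ≡ B + toℕ t → w′ ≡ w
      unique w′ w′∈ Xw′ with layer-offset w′∈
      ... | s , ℓw′≡ = vertex-unique q w′∈ (trans ℓw′≡ (cong (i +_) s≡q))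
        where
        offset≡t : (toℕ s + k′ * p) % k ≡ toℕ t
        offset≡t = +-cancelˡ-≡ B _ _ (trans (sym (X≡offset w′∈ s ℓw′≡)) Xw′)
        s≡q : toℕ s ≡ toℕ q
        s≡q = begin
          toℕ s                               ≡⟨ residue-offset p (toℕ<n s) ⟨
          ((toℕ s + k′ * p) % k + p) % k      ≡⟨ cong (λ z → (z + p) % k) offset≡t ⟩
          (toℕ t + p) % k                     ≡⟨ toℕ-residue (toℕ t + p) ⟨
          toℕ q                               ∎
          where open ≡-Reasoning

  start-unique : ∀ {f i j} → ∣ f ∣ ≡ k → LayerEdge k ℓ f i → LayerEdge k ℓ f j → i ≡ j
  start-unique sz f-at-i f-at-j = ≤-antisym (Edge.start≤ sz f-at-i f-at-j) (Edge.start≤ sz f-at-j f-at-i)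

LayerEdge-∸ : ∀ {m} k′ (X : Fin m → ℕ) {f B} c → LayerEdge (suc k′) X f B → (∀ v → v ∈ f → c ≤ X v) →
              LayerEdge (suc k′) (λ v → X v ∸ c) f (B ∸ c)
LayerEdge-∸ k′ X {f} {B} c f-at-B c≤X t with f-at-B t
... | w , w∈ , Xw≡ , unique = w , w∈ , trans (cong (_∸ c) Xw≡) (+-∸-comm (toℕ t) c≤B) , unique′
  where
  c≤B : c ≤ B
  c≤B with f-at-B Fin.zero
  ... | w₀ , w₀∈ , Xw₀≡ , _ = ≤-trans (c≤X w₀ w₀∈) (≤-reflexive (trans Xw₀≡ (+-identityʳ B)))
  unique′ : ∀ w′ → w′ ∈ f → X w′ ∸ c ≡ B ∸ c + toℕ t → w′ ≡ w
  unique′ w′ w′∈ eq = unique w′ w′∈ (begin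
    X w′                  ≡⟨ m∸n+n≡m (c≤X w′ w′∈) ⟨
    X w′ ∸ c + c          ≡⟨ cong (_+ c) eq ⟩
    B ∸ c + toℕ t + c     ≡⟨ +-assoc (B ∸ c) (toℕ t) c ⟩
    B ∸ c + (toℕ t + c)   ≡⟨ cong (B ∸ c +_) (+-comm (toℕ t) c) ⟩
    B ∸ c + (c + toℕ t)   ≡⟨ +-assoc (B ∸ c) c (toℕ t) ⟨
    B ∸ c + c + toℕ t     ≡⟨ cong (_+ toℕ t) (m∸n+n≡m c≤B) ⟩
    B + toℕ t             ∎)
    where open ≡-Reasoning

module LayerColouring {m : ℕ} (k′ : ℕ) (L : Fin m → ℕ) (L≥1 : ∀ v → 1 ≤ L v) where
  open Cyclic k′

  colourOf : Fin m → Fin k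
  colourOf v = residue (L v ∸ 1)

  layer≡colour : ∀ v → ∃ λ q → L v ≡ suc (toℕ (colourOf v)) + q * k
  layer≡colour v = (L v ∸ 1) / k , (begin
    L v                                          ≡⟨ m+[n∸m]≡n (L≥1 v) ⟨
    suc (L v ∸ 1)                                ≡⟨ cong suc (m≡m%n+[m/n]*n (L v ∸ 1) k) ⟩
    suc ((L v ∸ 1) % k + (L v ∸ 1) / k * k)      ≡⟨ cong (λ z → suc (z + (L v ∸ 1) / k * k)) (toℕ-residue (L v ∸ 1)) ⟨
    suc (toℕ (colourOf v)) + (L v ∸ 1) / k * k   ∎)
    where open ≡-Reasoning

  colourOf-proper : ∀ {f i} → ∣ f ∣ ≡ k → LayerEdge k L f i →
                    ∀ {v w} → v ∈ f → w ∈ f → colourOf v ≡ colourOf w → v ≡ w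
  colourOf-proper {f} {i} ∣f∣≡k f-at-i {v} {w} v∈ w∈ same =
    layer-injective v∈ w∈ (trans Lv≡ (trans (cong (i ∸ 1 +_) s≡t) (sym Lw≡)))
    where
    open Layered.Edge k′ (λ u → L u ∸ 1) ∣f∣≡k (LayerEdge-∸ k′ L 1 f-at-i (λ u _ → L≥1 u))
    s = proj₁ (layer-offset v∈)
    Lv≡ = proj₂ (layer-offset v∈)
    t = proj₁ (layer-offset w∈)
    Lw≡ = proj₂ (layer-offset w∈)
    residues : (i ∸ 1 + toℕ s) % k ≡ (i ∸ 1 + toℕ t) % k
    residues = begin
      (i ∸ 1 + toℕ s) % k        ≡⟨ cong (_% k) Lv≡ ⟨
      (L v ∸ 1) % k              ≡⟨ toℕ-residue (L v ∸ 1) ⟨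
      toℕ (colourOf v)           ≡⟨ cong toℕ same ⟩
      toℕ (colourOf w)           ≡⟨ toℕ-residue (L w ∸ 1) ⟩
      (L w ∸ 1) % k              ≡⟨ cong (_% k) Lw≡ ⟩
      (i ∸ 1 + toℕ t) % k        ∎
      where open ≡-Reasoning
    s≡t : toℕ s ≡ toℕ t
    s≡t = +-%-injective (i ∸ 1) (toℕ<n s) (toℕ<n t) residues

nonempty-∣p∣≡1 : ∀ {m} (p : Subset m) → ∣ p ∣ ≡ 1 → Subset.Nonempty p
nonempty-∣p∣≡1 {m} p ∣p∣≡1 with nonempty? p
... | yes ne = ne
... | no ¬ne = ⊥-elim (case trans (sym ∣p∣≡1) (trans (cong ∣_∣ (Empty-unique ¬ne)) (∣⊥∣≡0 m)) of λ ())

-- Every vertex other than the root lies in exactly one edge in which it is not the top (lowest-layer)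
-- vertex: its parent edge, whose top is its parent.
module RootedTree (k′ : ℕ) (T : RootedLooseTree (suc k′)) where
  open Cyclic k′ using (k)

  G : KGraph k
  G = tree T

  V : Set
  V = Fin (n G)

  E : List (Subset (n G))
  E = edges G

  ℓ : V → ℕ
  ℓ = layer T

  r : V
  r = root T

  edge-size : ∀ {f} → f ∈ᴸ E → ∣ f ∣ ≡ k
  edge-size = edgeSz G

  start : ∀ {f} → f ∈ᴸ E → ℕ
  start f∈ = proj₁ (edgeLayer T f∈)

  layered : ∀ {f} (f∈ : f ∈ᴸ E) → LayerEdge k ℓ f (start f∈)
  layered f∈ = proj₂ (edgeLayer T f∈)

  module EdgeOf {f} (f∈ : f ∈ᴸ E) = Layered.Edge k′ ℓ (edge-size f∈) (layered f∈)

  top : ∀ {f} → f ∈ᴸ E → V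
  top f∈ = EdgeOf.vertex f∈ Fin.zero

  top∈ : ∀ {f} (f∈ : f ∈ᴸ E) → top f∈ ∈ f
  top∈ f∈ = EdgeOf.vertex∈ f∈ Fin.zero

  layer-top : ∀ {f} (f∈ : f ∈ᴸ E) → ℓ (top f∈) ≡ start f∈
  layer-top f∈ = trans (EdgeOf.layer-vertex f∈ Fin.zero) (+-identityʳ _)

  top-unique : ∀ {f} (f∈ : f ∈ᴸ E) {u} → u ∈ f → ℓ u ≡ start f∈ → u ≡ top f∈
  top-unique f∈ u∈ ℓu≡ = EdgeOf.layer-injective f∈ u∈ (top∈ f∈) (trans ℓu≡ (sym (layer-top f∈)))

  top-irrelevant : ∀ {f} (f∈ f∈′ : f ∈ᴸ E) → top f∈ ≡ top f∈′
  top-irrelevant f∈ f∈′ = sym (top-unique f∈ (top∈ f∈′)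
    (trans (layer-top f∈′) (Layered.start-unique k′ ℓ (edge-size f∈′) (layered f∈′) (layered f∈))))

  lower-edge-unique : ∀ {f g} (f∈ : f ∈ᴸ E) (g∈ : g ∈ᴸ E) {u} → u ∈ f → u ∈ g →
                      ℓ u ≢ start f∈ → ℓ u ≢ start g∈ → f ≡ g
  lower-edge-unique f∈ g∈ {u} u∈f u∈g u-low-f u-low-g = atMostOne T u f∈ g∈ u∈f u∈g
    (λ f-at-u → u-low-f (Layered.start-unique k′ ℓ (edge-size f∈) f-at-u (layered f∈)))
    (λ g-at-u → u-low-g (Layered.start-unique k′ ℓ (edge-size g∈) g-at-u (layered g∈)))

  lower-top-unique : ∀ {f g} (f∈ : f ∈ᴸ E) (g∈ : g ∈ᴸ E) {u} → u ∈ f → u ∈ g →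
                     ℓ u ≢ start f∈ → ℓ u ≢ start g∈ → top f∈ ≡ top g∈
  lower-top-unique f∈ g∈ u∈f u∈g u-low-f u-low-g with lower-edge-unique f∈ g∈ u∈f u∈g u-low-f u-low-g
  ... | refl = top-irrelevant f∈ g∈

  root-is-top : ∀ {f} (f∈ : f ∈ᴸ E) → r ∈ f → ℓ r ≡ start f∈
  root-is-top f∈ r∈ = ≤-antisym (≤-trans (≤-reflexive (rootL₁ T)) 1≤start) (EdgeOf.start≤layer f∈ r∈)
    where
    1≤start : 1 ≤ start f∈
    1≤start = ≤-trans (layer≥1 T (top f∈)) (≤-reflexive (layer-top f∈))

  data Descent : V → ℕ → Set where
    at-root : Descent r 0
    below   : ∀ {f u d} (f∈ : f ∈ᴸ E) → u ∈ f → ℓ u ≢ start f∈ → Descent (top f∈) d → Descent u (suc d)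

  descent-parent : ∀ {u d} → Descent u d → V
  descent-parent at-root           = r
  descent-parent (below f∈ _ _ _) = top f∈

  descent-unique : ∀ {u d d′} (p : Descent u d) (q : Descent u d′) →
                   d ≡ d′ × descent-parent p ≡ descent-parent q
  descent-unique at-root                at-root                = refl , refl
  descent-unique at-root                (below f∈ r∈ r-low _)  = ⊥-elim (r-low (root-is-top f∈ r∈))
  descent-unique (below f∈ r∈ r-low _)  at-root                = ⊥-elim (r-low (root-is-top f∈ r∈))
  descent-unique (below f∈ u∈f u-low-f p) (below g∈ u∈g u-low-g q) =
    cong suc (proj₁ (descent-unique p (subst (λ z → Descent z _) (sym tops≡) q))) , tops≡
    where tops≡ = lower-top-unique f∈ g∈ u∈f u∈g u-low-f u-low-g

  Reached : V → Set
  Reached u = ∃ (Descent u)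

  reached-top : ∀ {f} (f∈ : f ∈ᴸ E) {u} → u ∈ f → Reached u → Reached (top f∈)
  reached-top f∈ {u} u∈ (d , p) with ℓ u ≟ start f∈
  ... | yes u-top = d , subst (λ z → Descent z d) (top-unique f∈ u∈ u-top) p
  reached-top f∈ u∈ (_ , at-root)             | no u-low = ⊥-elim (u-low (root-is-top f∈ u∈))
  reached-top f∈ u∈ (_ , below g∈ u∈g u-low-g p) | no u-low =
    _ , subst (λ z → Descent z _) (lower-top-unique g∈ f∈ u∈g u∈ u-low-g u-low) p

  reached-from-top : ∀ {f} (f∈ : f ∈ᴸ E) → Reached (top f∈) → ∀ {v} → v ∈ f → Reached v
  reached-from-top f∈ (d , p) {v} v∈ with ℓ v ≟ start f∈
  ... | yes v-top = d , subst (λ z → Descent z d) (sym (top-unique f∈ v∈ v-top)) p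
  ... | no v-low  = suc d , below f∈ v∈ v-low p

  -- Reachability spreads along the loose order of the edges, since each new edge meets the earlier ones.
  SpreadsOn : Subset (n G) → Set
  SpreadsOn U = ∀ {p q} → p ∈ U → q ∈ U → Reached p → Reached q

  spreads-on-edge : ∀ {f} → f ∈ᴸ E → SpreadsOn f
  spreads-on-edge f∈ p∈ q∈ reached-p = reached-from-top f∈ (reached-top f∈ p∈ reached-p) q∈

  spreads-on-∪ : ∀ {U e} → e ∈ᴸ E → ∣ e ∩ U ∣ ≡ 1 → SpreadsOn U → SpreadsOn (U ∪ e)
  spreads-on-∪ {U} {e} e∈ ∣e∩U∣≡1 on-U {p} {q} p∈ q∈ reached-p
    with nonempty-∣p∣≡1 (e ∩ U) ∣e∩U∣≡1
  ... | c , c∈ with x∈p∩q⁻ e U c∈ | x∈p∪q⁻ U e p∈ | x∈p∪q⁻ U e q∈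
  ... | c∈e , c∈U | inj₁ p∈U | inj₁ q∈U = on-U p∈U q∈U reached-p
  ... | c∈e , c∈U | inj₂ p∈e | inj₂ q∈e = spreads-on-edge e∈ p∈e q∈e reached-p
  ... | c∈e , c∈U | inj₁ p∈U | inj₂ q∈e = spreads-on-edge e∈ c∈e q∈e (on-U p∈U c∈U reached-p)
  ... | c∈e , c∈U | inj₂ p∈e | inj₁ q∈U = on-U c∈U q∈U (spreads-on-edge e∈ p∈e c∈e reached-p)

  spreads-on-⋃ : ∀ {U} es → LooseFrom U es → (∀ {e} → e ∈ᴸ es → e ∈ᴸ E) → SpreadsOn U → SpreadsOn (U ∪ ⋃ es)
  spreads-on-⋃ {U} []       _                 _   on-U = λ p∈ q∈ → on-U (to-U p∈) (to-U q∈)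
    where
    to-U : ∀ {x} → x ∈ U ∪ Subset.⊥ → x ∈ U
    to-U x∈ with x∈p∪q⁻ U Subset.⊥ x∈
    ... | inj₁ x∈U = x∈U
    ... | inj₂ x∈⊥ = ⊥-elim (∉⊥ x∈⊥)
  spreads-on-⋃ {U} (e ∷ es) (∣e∩U∣≡1 , loose) ⊆E on-U = λ p∈ q∈ → on-all (regroup p∈) (regroup q∈)
    where
    on-all : SpreadsOn ((U ∪ e) ∪ ⋃ es)
    on-all = spreads-on-⋃ es loose (⊆E ∘ there) (spreads-on-∪ (⊆E (here refl)) ∣e∩U∣≡1 on-U)
    regroup : ∀ {x} → x ∈ U ∪ (e ∪ ⋃ es) → x ∈ (U ∪ e) ∪ ⋃ es
    regroup x∈ = subst (_ ∈_) (sym (∪-assoc U e (⋃ es))) x∈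

  reached : ∀ u → Reached u
  reached u with isTree T
  ... | (e₁ ∷ es , es↭E , loose) , covered with covered u | covered r
  ... | f , f∈ , u∈f | g , g∈ , r∈g =
    spreads-on-⋃ es loose (λ e∈ → ∈-resp-↭ es↭E (there e∈)) (spreads-on-edge (∈-resp-↭ es↭E (here refl)))
      (in-all g∈ r∈g) (in-all f∈ u∈f) (0 , at-root)
    where
    in-all : ∀ {x f} → f ∈ᴸ E → x ∈ f → x ∈ e₁ ∪ ⋃ es
    in-all f∈ x∈ with ∈-resp-↭ (↭-sym es↭E) f∈
    ... | here refl = x∈p∪q⁺ (inj₁ x∈)
    ... | there f∈es = x∈p∪q⁺ (inj₂ (x∈⋃⁺ f∈es x∈))

  depth : V → ℕ
  depth u = proj₁ (reached u)

  descent : ∀ u → Descent u (depth u)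
  descent u = proj₂ (reached u)

  parent : V → V
  parent u = descent-parent (descent u)

  depth-root : depth r ≡ 0
  depth-root = proj₁ (descent-unique (descent r) at-root)

  parent-root : parent r ≡ r
  parent-root = proj₂ (descent-unique (descent r) at-root)

  depth≡0⇒root : ∀ {u} → depth u ≡ 0 → u ≡ r
  depth≡0⇒root {u} d≡0 with depth u | descent u
  depth≡0⇒root refl | .0 | at-root = refl

  lower-vertex : ∀ {f} (f∈ : f ∈ᴸ E) {v} → v ∈ f → ℓ v ≢ start f∈ →
                 parent v ≡ top f∈ × depth v ≡ suc (depth (top f∈))
  lower-vertex f∈ {v} v∈ v-low with descent-unique (descent v) (below f∈ v∈ v-low (descent (top f∈)))
  ... | depth≡ , parent≡ = parent≡ , depth≡

  parent-edge : ∀ u → u ≢ r → ∃ λ f → Σ (f ∈ᴸ E) λ f∈ → u ∈ f × ℓ u ≢ start f∈ × parent u ≡ top f∈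
  parent-edge u u≢r with depth u | descent u
  ... | _ | at-root             = ⊥-elim (u≢r refl)
  ... | _ | below f∈ u∈ u-low _ = _ , f∈ , u∈ , u-low , refl

  depth-parent : ∀ u → depth (parent u) ≡ depth u ∸ 1
  depth-parent u with u Fin.≟ r
  ... | yes refl = trans (cong depth parent-root) (trans depth-root (cong (_∸ 1) (sym depth-root)))
  ... | no u≢r with parent-edge u u≢r
  ... | f , f∈ , u∈ , u-low , parent≡ =
    trans (cong depth parent≡) (cong (_∸ 1) (sym (proj₂ (lower-vertex f∈ u∈ u-low))))

  depth-suc-parent : ∀ u → u ≢ r → depth u ≡ suc (depth (parent u))
  depth-suc-parent u u≢r with parent-edge u u≢r
  ... | f , f∈ , u∈ , u-low , parent≡ = trans (proj₂ (lower-vertex f∈ u∈ u-low)) (cong (suc ∘ depth) (sym parent≡))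

  top-or-lower : ∀ {f} (f∈ : f ∈ᴸ E) {v} → v ∈ f →
                 v ≡ top f∈ ⊎ (parent v ≡ top f∈ × depth v ≡ suc (depth (top f∈)))
  top-or-lower f∈ {v} v∈ with ℓ v ≟ start f∈
  ... | yes v-top = inj₁ (top-unique f∈ v∈ v-top)
  ... | no v-low  = inj₂ (lower-vertex f∈ v∈ v-low)

  depth-top≤ : ∀ {f} (f∈ : f ∈ᴸ E) {v} → v ∈ f → depth (top f∈) ≤ depth v
  depth-top≤ f∈ v∈ with top-or-lower f∈ v∈
  ... | inj₁ refl         = ≤-refl
  ... | inj₂ (_ , depth≡) = ≤-trans (n≤1+n _) (≤-reflexive (sym depth≡))

  depth≤1+depth-top : ∀ {f} (f∈ : f ∈ᴸ E) {v} → v ∈ f → depth v ≤ suc (depth (top f∈))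
  depth≤1+depth-top f∈ v∈ with top-or-lower f∈ v∈
  ... | inj₁ refl         = n≤1+n _
  ... | inj₂ (_ , depth≡) = ≤-reflexive depth≡

  depth-walk : ∀ {a b d} → Walk G a b d → depth b ≤ depth a + d
  depth-walk {a} (single e∈ a∈ b∈) = begin
    depth _                 ≤⟨ depth≤1+depth-top e∈ b∈ ⟩
    suc (depth (top e∈))    ≤⟨ s≤s (depth-top≤ e∈ a∈) ⟩
    suc (depth a)           ≡⟨ +-comm 1 (depth a) ⟩
    depth a + 1             ∎
    where open ≤-Reasoning
  depth-walk {a} {b} {suc d} (step {x = x} e∈ a∈ x∈ w) = begin
    depth b                 ≤⟨ depth-walk w ⟩
    depth x + d             ≤⟨ +-monoˡ-≤ d (depth≤1+depth-top e∈ x∈) ⟩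
    suc (depth (top e∈)) + d ≤⟨ +-monoˡ-≤ d (s≤s (depth-top≤ e∈ a∈)) ⟩
    suc (depth a) + d       ≡⟨ +-suc (depth a) d ⟨
    depth a + suc d         ∎
    where open ≤-Reasoning

  parent-adjacent : ∀ u → ∃ λ e → e ∈ᴸ E × parent u ∈ e × u ∈ e
  parent-adjacent u with u Fin.≟ r
  ... | yes refl with proj₂ (isTree T) r
  ... | e , e∈ , r∈ = e , e∈ , subst (_∈ e) (sym parent-root) r∈ , r∈
  parent-adjacent u | no u≢r with parent-edge u u≢r
  ... | f , f∈ , u∈ , _ , parent≡ = f , f∈ , subst (_∈ f) (sym parent≡) (top∈ f∈) , u∈

  ancestor : ℕ → V → V
  ancestor zero    u = u
  ancestor (suc i) u = parent (ancestor i u)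

  ancestor-suc : ∀ i u → ancestor (suc i) u ≡ ancestor i (parent u)
  ancestor-suc zero    u = refl
  ancestor-suc (suc i) u = cong parent (ancestor-suc i u)

  depth-ancestor : ∀ i u → depth (ancestor i u) ≡ depth u ∸ i
  depth-ancestor zero    u = refl
  depth-ancestor (suc i) u = begin
    depth (parent (ancestor i u))   ≡⟨ depth-parent (ancestor i u) ⟩
    depth (ancestor i u) ∸ 1        ≡⟨ cong (_∸ 1) (depth-ancestor i u) ⟩
    depth u ∸ i ∸ 1                 ≡⟨ ∸-+-assoc (depth u) i 1 ⟩
    depth u ∸ (i + 1)               ≡⟨ cong (depth u ∸_) (+-comm i 1) ⟩
    depth u ∸ suc i                 ∎
    where open ≡-Reasoning

  walk-to-ancestor : ∀ i u → Walk G (ancestor (suc i) u) u (suc i)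
  walk-to-ancestor zero u with parent-adjacent u
  ... | e , e∈ , parent∈ , u∈ = single e∈ parent∈ u∈
  walk-to-ancestor (suc i) u with parent-adjacent (ancestor (suc i) u)
  ... | e , e∈ , parent∈ , a∈ = step e∈ parent∈ a∈ (walk-to-ancestor i u)

  -- Depth changes by at most one along an edge, so no walk to u from its i-th ancestor is shorter than i.
  dist-ancestor : ∀ i u → i ≤ depth u → DistIs G (ancestor i u) u i
  dist-ancestor zero    u _      = inj₁ (refl , refl)
  dist-ancestor (suc i) u i<depth = inj₂ (ancestor≢u , walk-to-ancestor i u , no-shorter)
    where
    depths : depth (ancestor (suc i) u) + suc i ≡ depth u
    depths = trans (cong (_+ suc i) (depth-ancestor (suc i) u)) (m∸n+n≡m i<depth)
    ancestor≢u : ancestor (suc i) u ≢ u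
    ancestor≢u eq = m+1+n≢m (depth u) (trans (cong (λ z → depth z + suc i) (sym eq)) depths)
    no-shorter : ∀ d → d < suc i → ¬ Walk G (ancestor (suc i) u) u d
    no-shorter d d<i w = <⇒≱ d<i (+-cancelˡ-≤ (depth (ancestor (suc i) u)) _ _
                                   (≤-trans (≤-reflexive depths) (depth-walk w)))

  dist-root : ∀ u → DistIs G r u (depth u)
  dist-root u = subst (λ z → DistIs G z u (depth u)) root-ancestor (dist-ancestor (depth u) u ≤-refl)
    where
    root-ancestor : ancestor (depth u) u ≡ r
    root-ancestor = depth≡0⇒root (trans (depth-ancestor (depth u) u) (n∸n≡0 (depth u)))

  ball : ℕ → Subset (n G)
  ball m = tabulate (λ w → ⌊ depth w ≤? m ⌋)

  ∈-ball⁺ : ∀ {m u} → depth u ≤ m → u ∈ ball m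
  ∈-ball⁺ {m} {u} ≤m = ∈-tabulate⁺ _ (⇒isYes (depth u ≤? m) ≤m)

  ∈-ball⁻ : ∀ {m u} → u ∈ ball m → depth u ≤ m
  ∈-ball⁻ {m} {u} u∈ = isYes⇒ (depth u ≤? m) (∈-tabulate⁻ _ u∈)

  -- Each vertex of ball (m + 1) shares an edge with its parent, which lies in ball m.
  ∣ball∣≤ : ∀ {Δ} → (∀ w → degree G w ≤ Δ) → ∀ m → ∣ ball m ∣ ≤ (k * Δ) ^ m
  ∣ball∣≤ {Δ} deg≤Δ zero = ≤-trans (p⊆q⇒∣p∣≤∣q∣ ball0⊆r) (≤-reflexive (∣⁅x⁆∣≡1 r))
    where
    ball0⊆r : ball 0 ⊆ ⁅ r ⁆
    ball0⊆r {u} u∈ = subst (_∈ ⁅ r ⁆) (sym (depth≡0⇒root (n≤0⇒n≡0 (∈-ball⁻ u∈)))) (x∈⁅x⁆ r)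
  ∣ball∣≤ {Δ} deg≤Δ (suc m) = begin
    ∣ ball (suc m) ∣                           ≤⟨ p⊆q⇒∣p∣≤∣q∣ ball⊆ ⟩
    ∣ ⋃ᶠ (ball m) (neighbourhood E) ∣          ≤⟨ ∣⋃ᶠ∣≤ (ball m) (neighbourhood E) (k * Δ) ∣neighbourhood∣≤kΔ ⟩
    k * Δ * ∣ ball m ∣                         ≤⟨ *-monoʳ-≤ (k * Δ) (∣ball∣≤ deg≤Δ m) ⟩
    k * Δ * (k * Δ) ^ m                        ∎
    where
    open ≤-Reasoning
    ∣neighbourhood∣≤kΔ : ∀ t → t ∈ ball m → ∣ neighbourhood E t ∣ ≤ k * Δ
    ∣neighbourhood∣≤kΔ t _ = ≤-trans (∣neighbourhood∣≤ k E edge-size t) (*-monoʳ-≤ k (deg≤Δ t))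
    ball⊆ : ball (suc m) ⊆ ⋃ᶠ (ball m) (neighbourhood E)
    ball⊆ {u} u∈ with parent-adjacent u
    ... | e , e∈ , parent∈ , u∈e = x∈⋃ᶠ⁺ (ball m) (neighbourhood E) parent∈ball (∈-neighbourhood E e∈ parent∈ u∈e)
      where
      parent∈ball : parent u ∈ ball m
      parent∈ball = ∈-ball⁺ (≤-trans (≤-reflexive (depth-parent u)) (∸-monoˡ-≤ 1 (∈-ball⁻ u∈)))

indicator : ∀ {P : Set} → Dec P → ℕ
indicator (yes _) = 1
indicator (no _)  = 0

indicator-yes : ∀ {P : Set} (d : Dec P) → P → indicator d ≡ 1
indicator-yes (yes _) _ = refl
indicator-yes (no ¬p) p = ⊥-elim (¬p p)

indicator-no : ∀ {P : Set} (d : Dec P) → ¬ P → indicator d ≡ 0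
indicator-no (yes p) ¬p = ⊥-elim (¬p p)
indicator-no (no _)  _  = refl

+-split-∸ : ∀ {a b} c → a ≤ b → b + c ≡ a + c + (b ∸ a)
+-split-∸ {a} {b} c a≤b = trans (cong (_+ c) (sym (m+[n∸m]≡n a≤b))) (swap a (b ∸ a) c)
  where
  swap : ∀ x y z → x + y + z ≡ x + z + y
  swap = solve-∀

-- Vertices hanging off the r–s path keep their layer up to a multiple of k,
-- and each edge on the path is re-layered cyclically from its vertex nearer to s, so colours only rotate.
module Reroot (k′ : ℕ) (T : RootedLooseTree (suc k′)) (s : Fin (n (tree T))) where
  open Cyclic k′
  open RootedTree k′ T

  dₛ : ℕ
  dₛ = depth s

  pathAt : V → V
  pathAt u = ancestor (dₛ ∸ depth u) s

  OnPath : V → Set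
  OnPath a = depth a ≤ dₛ × pathAt a ≡ a

  InSubtree : V → Set
  InSubtree u = dₛ ≤ depth u × ancestor (depth u ∸ dₛ) u ≡ s

  InSubtree? : ∀ u → Dec (InSubtree u)
  InSubtree? u = (dₛ ≤? depth u) ×-dec (ancestor (depth u ∸ dₛ) u Fin.≟ s)

  ancestor-onPath : ∀ i → i ≤ dₛ → OnPath (ancestor i s) × depth (ancestor i s) ≡ dₛ ∸ i
  ancestor-onPath i i≤dₛ =
    (≤-trans (≤-reflexive (depth-ancestor i s)) (m∸n≤m dₛ i) ,
     cong (λ z → ancestor z s) (trans (cong (dₛ ∸_) (depth-ancestor i s)) (m∸[m∸n]≡n i≤dₛ))) ,
    depth-ancestor i s

  onPath-unique : ∀ {a b} → OnPath a → OnPath b → depth a ≡ depth b → a ≡ b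
  onPath-unique (_ , a≡) (_ , b≡) depth≡ = trans (sym a≡) (trans (cong (λ z → ancestor (dₛ ∸ z) s) depth≡) b≡)

  onPath-parent : ∀ {a} → OnPath a → 1 ≤ depth a → OnPath (parent a)
  onPath-parent {a} (a≤dₛ , a≡) 1≤a =
    ≤-trans (≤-reflexive (depth-parent a)) (≤-trans (m∸n≤m (depth a) 1) a≤dₛ) ,
    trans (cong (λ z → ancestor z s) one-more) (cong parent a≡)
    where
    one-more : dₛ ∸ depth (parent a) ≡ suc (dₛ ∸ depth a)
    one-more = trans (cong (dₛ ∸_) (depth-parent a)) (∸-pred 1≤a a≤dₛ)
      where
      ∸-pred : ∀ {x} → 1 ≤ x → x ≤ dₛ → dₛ ∸ (x ∸ 1) ≡ suc (dₛ ∸ x)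
      ∸-pred {suc x} _ x<dₛ = +-∸-assoc 1 x<dₛ

  s-onPath : OnPath s
  s-onPath = ≤-refl , cong (λ z → ancestor z s) (n∸n≡0 dₛ)

  root-onPath : OnPath r
  root-onPath = ≤-trans (≤-reflexive depth-root) z≤n ,
    trans (cong (λ z → ancestor (dₛ ∸ z) s) depth-root)
          (depth≡0⇒root (trans (depth-ancestor dₛ s) (n∸n≡0 dₛ)))

  s-inSubtree : InSubtree s
  s-inSubtree = ≤-refl , cong (λ z → ancestor z s) (n∸n≡0 dₛ)

  inSubtree∧onPath⇒s : ∀ {a} → InSubtree a → OnPath a → a ≡ s
  inSubtree∧onPath⇒s {a} (_ , a↑≡s) (a≤dₛ , _) = trans (sym (cong (λ z → ancestor z a) (m≤n⇒m∸n≡0 a≤dₛ))) a↑≡s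

  inSubtree-child : ∀ {t v} → InSubtree t → parent v ≡ t → depth v ≡ suc (depth t) → InSubtree v
  inSubtree-child {t} {v} (dₛ≤t , t↑≡s) parent≡ depth≡ =
    ≤-trans dₛ≤t (≤-trans (n≤1+n _) (≤-reflexive (sym depth≡))) ,
    trans (cong (λ z → ancestor z v) (trans (cong (_∸ dₛ) depth≡) (+-∸-assoc 1 dₛ≤t)))
          (trans (ancestor-suc (depth t ∸ dₛ) v) (trans (cong (ancestor (depth t ∸ dₛ)) parent≡) t↑≡s))

  inSubtree-parent : ∀ {v} → InSubtree v → v ≢ s → v ≢ r × InSubtree (parent v)
  inSubtree-parent {v} (dₛ≤v , v↑≡s) v≢s with depth v ∸ dₛ in eq
  ... | zero  = ⊥-elim (v≢s v↑≡s)
  ... | suc i = v≢r , dₛ≤parent , trans (cong (λ z → ancestor z (parent v)) i≡) (trans (sym (ancestor-suc i v)) v↑≡s)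
    where
    v≢r : v ≢ r
    v≢r refl = case trans (sym eq) (trans (cong (_∸ dₛ) depth-root) (0∸n≡0 dₛ)) of λ ()
    depth≡ : depth v ≡ suc (depth (parent v))
    depth≡ = depth-suc-parent v v≢r
    dₛ≤parent : dₛ ≤ depth (parent v)
    dₛ≤parent = ≤-pred (≤-trans (m∸n≢0⇒n<m (λ e → case trans (sym eq) e of λ ())) (≤-reflexive depth≡))
    i≡ : depth (parent v) ∸ dₛ ≡ i
    i≡ = suc-injective (trans (sym (+-∸-assoc 1 dₛ≤parent)) (trans (cong (_∸ dₛ) (sym depth≡)) eq))

  parentEdgeSet : V → Subset (n G)
  parentEdgeSet u with u Fin.≟ r
  ... | yes _   = Subset.⊥
  ... | no u≢r = proj₁ (parent-edge u u≢r)

  parentEdgeSet-lower : ∀ {f} (f∈ : f ∈ᴸ E) {v} → v ∈ f → ℓ v ≢ start f∈ → parentEdgeSet v ≡ f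
  parentEdgeSet-lower f∈ {v} v∈ v-low with v Fin.≟ r
  ... | yes refl = ⊥-elim (v-low (root-is-top f∈ v∈))
  ... | no v≢r with parent-edge v v≢r
  ... | g , g∈ , v∈g , v-low-g , _ = lower-edge-unique g∈ f∈ v∈g v∈ v-low-g v-low

  ∈-parentEdgeSet : ∀ u → u ≢ r → u ∈ parentEdgeSet u
  ∈-parentEdgeSet u u≢r with u Fin.≟ r
  ... | yes u≡r = ⊥-elim (u≢r u≡r)
  ... | no u≢r′ = proj₁ (proj₂ (proj₂ (parent-edge u u≢r′)))

  -- u and the path vertex at its depth share their parent edge (they may coincide).
  PathSibling : V → Set
  PathSibling u = depth u ≤ dₛ × pathAt u ∈ parentEdgeSet u

  PathSibling? : ∀ u → Dec (PathSibling u)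
  PathSibling? u = (depth u ≤? dₛ) ×-dec (pathAt u ∈? parentEdgeSet u)

  -- How many blocks of k layers u is lifted by; the fuel depth u suffices to climb to the root.
  raiseWithin : ℕ → V → ℕ
  raiseWithin zero u with InSubtree? u
  ... | yes _ = 0
  ... | no _  = dₛ
  raiseWithin (suc fuel) u with InSubtree? u
  ... | yes _ = 0
  ... | no _ with PathSibling? u
  ...   | yes _ = (dₛ ∸ depth u) + indicator (ℓ u <? ℓ (pathAt u))
  ...   | no _  = raiseWithin fuel (parent u)

  raise : V → ℕ
  raise u = raiseWithin (depth u) u

  raised : V → ℕ
  raised u = ℓ u + k * raise u

  raise-inSubtree : ∀ {u} → InSubtree u → raise u ≡ 0
  raise-inSubtree {u} in-sub = within (depth u)
    where
    within : ∀ fuel → raiseWithin fuel u ≡ 0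
    within zero with InSubtree? u
    ... | yes _  = refl
    ... | no ¬in = ⊥-elim (¬in in-sub)
    within (suc _) with InSubtree? u
    ... | yes _  = refl
    ... | no ¬in = ⊥-elim (¬in in-sub)

  raise-root : ¬ InSubtree r → raise r ≡ dₛ
  raise-root ¬in = within (depth r) depth-root
    where
    within : ∀ fuel → fuel ≡ 0 → raiseWithin fuel r ≡ dₛ
    within zero _ with InSubtree? r
    ... | yes in-sub = ⊥-elim (¬in in-sub)
    ... | no _       = refl

  raise-sibling : ∀ {u} → ¬ InSubtree u → PathSibling u → u ≢ r →
                  raise u ≡ (dₛ ∸ depth u) + indicator (ℓ u <? ℓ (pathAt u))
  raise-sibling {u} ¬in sib u≢r = within (depth u) (depth-suc-parent u u≢r)
    where
    within : ∀ fuel → fuel ≡ suc (depth (parent u)) →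
             raiseWithin fuel u ≡ (dₛ ∸ depth u) + indicator (ℓ u <? ℓ (pathAt u))
    within (suc _) _ with InSubtree? u
    ... | yes in-sub = ⊥-elim (¬in in-sub)
    ... | no _ with PathSibling? u
    ...   | yes _   = refl
    ...   | no ¬sib = ⊥-elim (¬sib sib)

  raise-parent : ∀ {u} → ¬ InSubtree u → ¬ PathSibling u → u ≢ r → raise u ≡ raise (parent u)
  raise-parent {u} ¬in ¬sib u≢r = within (depth u) (depth-suc-parent u u≢r)
    where
    within : ∀ fuel → fuel ≡ suc (depth (parent u)) → raiseWithin fuel u ≡ raise (parent u)
    within (suc fuel) fuel≡ with InSubtree? u
    ... | yes in-sub = ⊥-elim (¬in in-sub)
    ... | no _ with PathSibling? u
    ...   | yes sib = ⊥-elim (¬sib sib)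
    ...   | no _    = cong (λ z → raiseWithin z (parent u)) (suc-injective fuel≡)

  raise-onPath : ∀ {a} → OnPath a → raise a ≡ dₛ ∸ depth a
  raise-onPath {a} on-path with InSubtree? a
  ... | yes in-sub = trans (raise-inSubtree in-sub)
                           (sym (trans (cong (λ z → dₛ ∸ depth z) (inSubtree∧onPath⇒s in-sub on-path)) (n∸n≡0 dₛ)))
  ... | no ¬in with a Fin.≟ r
  ... | yes refl = trans (raise-root ¬in) (cong (dₛ ∸_) (sym depth-root))
  ... | no a≢r = trans (raise-sibling ¬in sibling a≢r)
                       (trans (cong (dₛ ∸ depth a +_) (indicator-no (ℓ a <? ℓ (pathAt a)) ℓa≮ℓa)) (+-identityʳ _))
    where
    sibling : PathSibling a
    sibling = proj₁ on-path , subst (_∈ parentEdgeSet a) (sym (proj₂ on-path)) (∈-parentEdgeSet a a≢r)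
    ℓa≮ℓa : ¬ ℓ a < ℓ (pathAt a)
    ℓa≮ℓa = subst (λ z → ¬ ℓ a < ℓ z) (sym (proj₂ on-path)) (<-irrefl refl)

  pathChild : ∀ {f} → f ∈ᴸ E → V
  pathChild f∈ = ancestor (dₛ ∸ suc (depth (top f∈))) s

  -- f lies on the r–s path: its path child is one of its lower vertices.
  PathEdge : ∀ {f} → f ∈ᴸ E → Set
  PathEdge {f} f∈ = suc (depth (top f∈)) ≤ dₛ × pathChild f∈ ∈ f

  PathEdge? : ∀ {f} (f∈ : f ∈ᴸ E) → Dec (PathEdge f∈)
  PathEdge? {f} f∈ = (suc (depth (top f∈)) ≤? dₛ) ×-dec (pathChild f∈ ∈? f)

  pathChild-onPath : ∀ {f} (f∈ : f ∈ᴸ E) → suc (depth (top f∈)) ≤ dₛ →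
                     OnPath (pathChild f∈) × depth (pathChild f∈) ≡ suc (depth (top f∈))
  pathChild-onPath f∈ below-s with ancestor-onPath (dₛ ∸ suc (depth (top f∈))) (m∸n≤m dₛ (suc (depth (top f∈))))
  ... | on-path , depth≡ = on-path , trans depth≡ (m∸[m∸n]≡n below-s)

  pathChild-lower : ∀ {f} (f∈ : f ∈ᴸ E) → PathEdge f∈ → ℓ (pathChild f∈) ≢ start f∈
  pathChild-lower f∈ (below-s , child∈) ℓ≡ =
    1+n≢n (trans (sym (proj₂ (pathChild-onPath f∈ below-s))) (cong depth (top-unique f∈ child∈ ℓ≡)))

  parent-pathChild : ∀ {f} (f∈ : f ∈ᴸ E) → PathEdge f∈ → parent (pathChild f∈) ≡ top f∈
  parent-pathChild f∈ path = proj₁ (lower-vertex f∈ (proj₂ path) (pathChild-lower f∈ path))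

  top-onPath : ∀ {f} (f∈ : f ∈ᴸ E) → PathEdge f∈ → OnPath (top f∈)
  top-onPath f∈ path with pathChild-onPath f∈ (proj₁ path)
  ... | on-path , depth≡ = subst OnPath (parent-pathChild f∈ path)
                             (onPath-parent on-path (≤-trans (s≤s z≤n) (≤-reflexive (sym depth≡))))

  raise-offPath-edge : ∀ {f} (f∈ : f ∈ᴸ E) → ¬ PathEdge f∈ → ∀ {v} → v ∈ f → raise v ≡ raise (top f∈)
  raise-offPath-edge f∈ ¬path {v} v∈ with ℓ v ≟ start f∈
  ... | yes v-top = cong raise (top-unique f∈ v∈ v-top)
  ... | no v-low with lower-vertex f∈ v∈ v-low | InSubtree? (top f∈)
  ...   | parent≡ , depth≡ | yes top-in = trans (raise-inSubtree (inSubtree-child top-in parent≡ depth≡))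
                                               (sym (raise-inSubtree top-in))
  ...   | parent≡ , depth≡ | no top-out = trans (raise-parent v-out v-not-sibling v≢r) (cong raise parent≡)
    where
    v≢r : v ≢ r
    v≢r refl = v-low (root-is-top f∈ v∈)
    pathAt≡ : pathAt v ≡ pathChild f∈
    pathAt≡ = cong (λ z → ancestor (dₛ ∸ z) s) depth≡
    v-out : ¬ InSubtree v
    v-out v-in with v Fin.≟ s
    ... | yes refl = ¬path (≤-reflexive (sym depth≡) , subst (_∈ _) (trans (sym (proj₂ s-onPath)) pathAt≡) v∈)
    ... | no v≢s = top-out (subst InSubtree parent≡ (proj₂ (inSubtree-parent v-in v≢s)))
    v-not-sibling : ¬ PathSibling v
    v-not-sibling (v≤dₛ , pathAt∈) = ¬path (≤-trans (≤-reflexive (sym depth≡)) v≤dₛ ,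
      subst (_∈ _) pathAt≡ (subst (pathAt v ∈_) (parentEdgeSet-lower f∈ v∈ v-low) pathAt∈))

  pathEdgeRaise : ∀ {f} → f ∈ᴸ E → ℕ
  pathEdgeRaise f∈ = dₛ ∸ suc (depth (top f∈))

  layer-top<pathChild : ∀ {f} (f∈ : f ∈ᴸ E) → PathEdge f∈ → ℓ (top f∈) < ℓ (pathChild f∈)
  layer-top<pathChild f∈ path@(_ , child∈) =
    ≤∧≢⇒< (≤-trans (≤-reflexive (layer-top f∈)) (EdgeOf.start≤layer f∈ child∈))
          (λ eq → pathChild-lower f∈ path (trans (sym eq) (layer-top f∈)))

  raise-path-edge : ∀ {f} (f∈ : f ∈ᴸ E) → PathEdge f∈ → ∀ {v} → v ∈ f →
                    raise v ≡ pathEdgeRaise f∈ + indicator (ℓ v <? ℓ (pathChild f∈))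
  raise-path-edge f∈ path@(below-s , child∈) {v} v∈ with ℓ v ≟ start f∈
  ... | yes v-top rewrite top-unique f∈ v∈ v-top = begin
    raise (top f∈)                          ≡⟨ raise-onPath (top-onPath f∈ path) ⟩
    dₛ ∸ depth (top f∈)                     ≡⟨ +-∸-assoc 1 below-s ⟩
    suc (pathEdgeRaise f∈)                  ≡⟨ +-comm 1 _ ⟩
    pathEdgeRaise f∈ + 1                    ≡⟨ cong (pathEdgeRaise f∈ +_)
                                                    (indicator-yes (ℓ (top f∈) <? _) (layer-top<pathChild f∈ path)) ⟨
    pathEdgeRaise f∈ + indicator (ℓ (top f∈) <? ℓ (pathChild f∈)) ∎
    where open ≡-Reasoning
  ... | no v-low with lower-vertex f∈ v∈ v-low | InSubtree? v
  ...   | parent≡ , depth≡ | yes v-in = begin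
    raise v                                 ≡⟨ raise-inSubtree v-in ⟩
    0                                       ≡⟨ cong₂ _+_ raise0 (indicator-no (ℓ v <? ℓ (pathChild f∈)) ℓv≮ℓchild) ⟨
    pathEdgeRaise f∈ + indicator (ℓ v <? ℓ (pathChild f∈)) ∎
    where
    open ≡-Reasoning
    v≡s : v ≡ s
    v≡s with v Fin.≟ s
    ... | yes v≡s = v≡s
    ... | no v≢s = ⊥-elim (<⇒≱ below-s (proj₁ (subst InSubtree parent≡ (proj₂ (inSubtree-parent v-in v≢s)))))
    child≡v : pathChild f∈ ≡ v
    child≡v with pathChild-onPath f∈ below-s
    ... | on-path , depth-child≡ =
      trans (onPath-unique on-path s-onPath (trans depth-child≡ (trans (sym depth≡) (cong depth v≡s)))) (sym v≡s)
    ℓv≮ℓchild : ¬ ℓ v < ℓ (pathChild f∈)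
    ℓv≮ℓchild = subst (λ z → ¬ ℓ v < ℓ z) (sym child≡v) (<-irrefl refl)
    raise0 : pathEdgeRaise f∈ ≡ 0
    raise0 = trans (cong (λ z → dₛ ∸ z) (trans (sym depth≡) (cong depth v≡s))) (n∸n≡0 dₛ)
  ...   | parent≡ , depth≡ | no v-out =
    trans (raise-sibling v-out sibling v≢r) (cong₂ (λ a b → a + indicator (ℓ v <? ℓ b)) (cong (dₛ ∸_) depth≡) pathAt≡)
    where
    v≢r : v ≢ r
    v≢r refl = v-low (root-is-top f∈ v∈)
    pathAt≡ : pathAt v ≡ pathChild f∈
    pathAt≡ = cong (λ z → ancestor (dₛ ∸ z) s) depth≡
    sibling : PathSibling v
    sibling = ≤-trans (≤-reflexive depth≡) below-s ,
              subst (_∈ parentEdgeSet v) (sym pathAt≡) (subst (pathChild f∈ ∈_) (sym (parentEdgeSet-lower f∈ v∈ v-low)) child∈)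

  newTop : ∀ {f} → f ∈ᴸ E → V
  newTop f∈ with PathEdge? f∈
  ... | yes _ = pathChild f∈
  ... | no _  = top f∈

  newTop-path : ∀ {f} (f∈ : f ∈ᴸ E) → PathEdge f∈ → newTop f∈ ≡ pathChild f∈
  newTop-path f∈ path with PathEdge? f∈
  ... | yes _    = refl
  ... | no ¬path = ⊥-elim (¬path path)

  newTop-offPath : ∀ {f} (f∈ : f ∈ᴸ E) → ¬ PathEdge f∈ → newTop f∈ ≡ top f∈
  newTop-offPath f∈ ¬path with PathEdge? f∈
  ... | yes path = ⊥-elim (¬path path)
  ... | no _     = refl

  Relayered : ∀ {f} → f ∈ᴸ E → V → Set
  Relayered {f} f∈ a = ∀ v → v ∈ f → raised v ≡ raised a + offset (ℓ a) (ℓ v)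

  relayered-offPath : ∀ {f} (f∈ : f ∈ᴸ E) → ¬ PathEdge f∈ → Relayered f∈ (top f∈)
  relayered-offPath f∈ ¬path v v∈ = begin
    ℓ v + k * raise v                                ≡⟨ cong (λ z → ℓ v + k * z) (raise-offPath-edge f∈ ¬path v∈) ⟩
    ℓ v + k * raise (top f∈)                         ≡⟨ +-split-∸ (k * raise (top f∈)) top≤v ⟩
    raised (top f∈) + (ℓ v ∸ ℓ (top f∈))             ≡⟨ cong (raised (top f∈) +_) (offset-≤ top≤v v<top+k) ⟨
    raised (top f∈) + offset (ℓ (top f∈)) (ℓ v)      ∎
    where
    open ≡-Reasoning
    top≤v : ℓ (top f∈) ≤ ℓ v
    top≤v = ≤-trans (≤-reflexive (layer-top f∈)) (EdgeOf.start≤layer f∈ v∈)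
    v<top+k : ℓ v < ℓ (top f∈) + k
    v<top+k = ≤-trans (EdgeOf.layer<start+k f∈ v∈) (≤-reflexive (cong (_+ k) (sym (layer-top f∈))))

  -- Vertices of a path edge in layers before the path child wrap around: they are lifted one block more.
  relayered-path : ∀ {f} (f∈ : f ∈ᴸ E) → PathEdge f∈ → Relayered f∈ (pathChild f∈)
  relayered-path {f} f∈ path v v∈ = compare (ℓ v <? ℓ a)
    where
    a = pathChild f∈
    a∈ = proj₂ path
    H = pathEdgeRaise f∈
    raised-a : raised a ≡ ℓ a + k * H
    raised-a = cong (λ z → ℓ a + k * z) (trans (raise-path-edge f∈ path a∈)
      (trans (cong (H +_) (indicator-no (ℓ a <? ℓ a) (<-irrefl refl))) (+-identityʳ H)))
    compare : Dec (ℓ v < ℓ a) → raised v ≡ raised a + offset (ℓ a) (ℓ v)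
    compare (yes v<a) = begin
      ℓ v + k * raise v                      ≡⟨ cong (λ z → ℓ v + k * z) (raise-path-edge f∈ path v∈) ⟩
      ℓ v + k * (H + indicator (ℓ v <? ℓ a)) ≡⟨ cong (λ z → ℓ v + k * (H + z)) (indicator-yes (ℓ v <? ℓ a) v<a) ⟩
      ℓ v + k * (H + 1)                      ≡⟨ one-more-block (ℓ v) k H ⟩
      ℓ v + k + k * H                        ≡⟨ +-split-∸ (k * H) (<⇒≤ a<v+k) ⟩
      ℓ a + k * H + (ℓ v + k ∸ ℓ a)          ≡⟨ cong₂ _+_ (sym raised-a) (sym (offset-> v<a a<v+k)) ⟩
      raised a + offset (ℓ a) (ℓ v)          ∎
      where
      open ≡-Reasoning
      one-more-block : ∀ x k H → x + k * (H + 1) ≡ x + k + k * H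
      one-more-block = solve-∀
      a<v+k : ℓ a < ℓ v + k
      a<v+k = ≤-trans (EdgeOf.layer<start+k f∈ a∈) (+-monoˡ-≤ k (EdgeOf.start≤layer f∈ v∈))
    compare (no v≮a) = begin
      ℓ v + k * raise v                      ≡⟨ cong (λ z → ℓ v + k * z) (raise-path-edge f∈ path v∈) ⟩
      ℓ v + k * (H + indicator (ℓ v <? ℓ a)) ≡⟨ cong (λ z → ℓ v + k * (H + z)) (indicator-no (ℓ v <? ℓ a) v≮a) ⟩
      ℓ v + k * (H + 0)                      ≡⟨ cong (λ z → ℓ v + k * z) (+-identityʳ H) ⟩
      ℓ v + k * H                            ≡⟨ +-split-∸ (k * H) (≮⇒≥ v≮a) ⟩
      ℓ a + k * H + (ℓ v ∸ ℓ a)              ≡⟨ cong₂ _+_ (sym raised-a) (sym (offset-≤ (≮⇒≥ v≮a) v<a+k)) ⟩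
      raised a + offset (ℓ a) (ℓ v)          ∎
      where
      open ≡-Reasoning
      v<a+k : ℓ v < ℓ a + k
      v<a+k = ≤-trans (EdgeOf.layer<start+k f∈ v∈) (+-monoˡ-≤ k (EdgeOf.start≤layer f∈ a∈))

  newTop∈ : ∀ {f} (f∈ : f ∈ᴸ E) → newTop f∈ ∈ f
  newTop∈ f∈ with PathEdge? f∈
  ... | yes path = proj₂ path
  ... | no _     = top∈ f∈

  relayered-newTop : ∀ {f} (f∈ : f ∈ᴸ E) → Relayered f∈ (newTop f∈)
  relayered-newTop f∈ with PathEdge? f∈
  ... | yes path = relayered-path f∈ path
  ... | no ¬path = relayered-offPath f∈ ¬path

  raised-newTop< : ∀ {f} (f∈ : f ∈ᴸ E) {v} → v ∈ f → v ≢ newTop f∈ → raised (newTop f∈) < raised v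
  raised-newTop< f∈ v∈ v≢newTop = begin-strict
    raised (newTop f∈)                               <⟨ m<m+n _ (EdgeOf.offset-positive f∈ (newTop∈ f∈) v∈ v≢newTop) ⟩
    raised (newTop f∈) + offset (ℓ (newTop f∈)) (ℓ _) ≡⟨ relayered-newTop f∈ _ v∈ ⟨
    raised _                                          ∎
    where open ≤-Reasoning

  raised-s : raised s ≡ ℓ s
  raised-s = trans (cong (λ z → ℓ s + k * z) (raise-inSubtree s-inSubtree)) (trans (cong (ℓ s +_) (*-zeroʳ k)) (+-identityʳ _))

  -- s will be the only vertex in the new first layer.
  Bounded : V → Set
  Bounded v = ℓ s ≤ raised v × (v ≢ s → ℓ s < raised v)

  bounded-edge : ∀ {f} (f∈ : f ∈ᴸ E) → Bounded (newTop f∈) → ∀ {v} → v ∈ f → Bounded v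
  bounded-edge f∈ bounded@(s≤top , _) {v} v∈ with v Fin.≟ newTop f∈
  ... | yes refl = bounded
  ... | no v≢top = ≤-trans s≤top (<⇒≤ top<v) , λ _ → ≤-<-trans s≤top top<v
    where top<v = raised-newTop< f∈ v∈ v≢top

  onPath-bounded : ∀ i {a} → OnPath a → dₛ ∸ depth a ≡ i → Bounded a
  onPath-bounded zero    (_ , a≡) i≡ = subst Bounded (trans (cong (λ z → ancestor z s) (sym i≡)) a≡)
                                             (≤-reflexive (sym raised-s) , λ s≢s → ⊥-elim (s≢s refl))
  onPath-bounded (suc i) {a} (a≤dₛ , a≡) i≡ = subst Bounded top≡a (bounded-edge f∈ child-bounded (top∈ f∈))
    where
    a<dₛ : depth a < dₛ
    a<dₛ = m∸n≢0⇒n<m (λ eq → case trans (sym i≡) eq of λ ())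
    i<dₛ : i < dₛ
    i<dₛ = subst (_≤ dₛ) i≡ (m∸n≤m dₛ (depth a))
    c = ancestor i s
    c-onPath : OnPath c × depth c ≡ dₛ ∸ i
    c-onPath = ancestor-onPath i (<⇒≤ i<dₛ)
    c≢r : c ≢ r
    c≢r c≡r = m>n⇒m∸n≢0 i<dₛ (trans (sym (proj₂ c-onPath)) (trans (cong depth c≡r) depth-root))
    edge = parent-edge c c≢r
    f = proj₁ edge
    f∈ : f ∈ᴸ E
    f∈ = proj₁ (proj₂ edge)
    c∈ : c ∈ f
    c∈ = proj₁ (proj₂ (proj₂ edge))
    parent≡top : parent c ≡ top f∈
    parent≡top = proj₂ (proj₂ (proj₂ (proj₂ edge)))
    top≡a : top f∈ ≡ a
    top≡a = trans (sym parent≡top) (trans (cong (λ z → ancestor z s) (sym i≡)) a≡)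
    child≡c : pathChild f∈ ≡ c
    child≡c = cong (λ z → ancestor z s) (trans (cong (λ z → dₛ ∸ suc (depth z)) top≡a)
                                               (suc-injective (trans (sym (+-∸-assoc 1 a<dₛ)) i≡)))
    path : PathEdge f∈
    path = subst (λ z → suc (depth z) ≤ dₛ) (sym top≡a) a<dₛ , subst (_∈ f) (sym child≡c) c∈
    child-bounded : Bounded (newTop f∈)
    child-bounded = subst Bounded (sym (trans (newTop-path f∈ path) child≡c))
      (onPath-bounded i (proj₁ c-onPath) (trans (cong (dₛ ∸_) (proj₂ c-onPath)) (m∸[m∸n]≡n (<⇒≤ i<dₛ))))

  bounded : ∀ v → Bounded v
  bounded v = bounded-at (depth v) v refl
    where
    bounded-at : ∀ d v → depth v ≡ d → Bounded v
    bounded-at d v depth≡ with v Fin.≟ r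
    ... | yes refl = onPath-bounded _ root-onPath refl
    ... | no v≢r with parent-edge v v≢r
    ... | f , f∈ , v∈ , v-low , parent≡top with PathEdge? f∈
    ...   | yes path = bounded-edge f∈ (subst Bounded (sym (newTop-path f∈ path))
                                           (onPath-bounded _ (proj₁ (pathChild-onPath f∈ (proj₁ path))) refl)) v∈
    ...   | no ¬path = bounded-edge f∈ (subst Bounded (sym (newTop-offPath f∈ ¬path)) (bounded-at-parent d depth≡)) v∈
      where
      bounded-at-parent : ∀ d → depth v ≡ d → Bounded (top f∈)
      bounded-at-parent (suc d) depth≡ = bounded-at d (top f∈)
        (suc-injective (trans (sym (proj₂ (lower-vertex f∈ v∈ v-low))) depth≡))
      bounded-at-parent zero depth≡ = ⊥-elim (v≢r (depth≡0⇒root depth≡))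

  -- Shift so that s lands in layer 1 (ℓ s ≥ 1, so no truncation occurs below).
  newLayer : V → ℕ
  newLayer v = raised v ∸ (ℓ s ∸ 1)

  newLayer-edge : ∀ {f} (f∈ : f ∈ᴸ E) → LayerEdge k newLayer f (newLayer (newTop f∈))
  newLayer-edge f∈ = LayerEdge-∸ k′ raised (ℓ s ∸ 1)
    (EdgeOf.relayer f∈ (newTop∈ f∈) raised (raised (newTop f∈)) (relayered-newTop f∈))
    (λ v _ → ≤-trans (m∸n≤m (ℓ s) 1) (proj₁ (bounded v)))

  1+[ℓs∸1]≡ℓs : suc (ℓ s ∸ 1) ≡ ℓ s
  1+[ℓs∸1]≡ℓs = m+[n∸m]≡n (layer≥1 T s)

  newLayer≥1 : ∀ v → 1 ≤ newLayer v
  newLayer≥1 v = m<n⇒0<n∸m (≤-trans (≤-reflexive 1+[ℓs∸1]≡ℓs) (proj₁ (bounded v)))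

  newLayer-s : newLayer s ≡ 1
  newLayer-s = trans (cong (_∸ (ℓ s ∸ 1)) raised-s) (m∸[m∸n]≡n (layer≥1 T s))

  newLayer≡1⇒s : ∀ v → newLayer v ≡ 1 → v ≡ s
  newLayer≡1⇒s v newLayer≡1 with v Fin.≟ s
  ... | yes v≡s = v≡s
  ... | no v≢s = ⊥-elim (case ≤-trans 2≤newLayer (≤-reflexive newLayer≡1) of λ { (s≤s ()) })
    where
    2≤newLayer : 2 ≤ newLayer v
    2≤newLayer = ≤-trans (≤-reflexive (sym (m+n∸m≡n (ℓ s ∸ 1) 2)))
      (∸-monoˡ-≤ (ℓ s ∸ 1) (≤-trans (≤-reflexive (trans (+-comm (ℓ s ∸ 1) 2) (cong suc 1+[ℓs∸1]≡ℓs)))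
                                    (proj₂ (bounded v) v≢s)))

  lower∧onPath⇒newTop : ∀ {f} (f∈ : f ∈ᴸ E) {v} → v ∈ f → ℓ v ≢ start f∈ → OnPath v → v ≡ newTop f∈
  lower∧onPath⇒newTop f∈ {v} v∈ v-low (v≤dₛ , v≡) = trans (sym child≡v) (sym (newTop-path f∈ path))
    where
    depth≡ : depth v ≡ suc (depth (top f∈))
    depth≡ = proj₂ (lower-vertex f∈ v∈ v-low)
    child≡v : pathChild f∈ ≡ v
    child≡v = trans (cong (λ z → ancestor (dₛ ∸ z) s) (sym depth≡)) v≡
    path : PathEdge f∈
    path = ≤-trans (≤-reflexive (sym depth≡)) v≤dₛ , subst (_∈ _) (sym child≡v) v∈

  top≢newTop⇒path : ∀ {f} (f∈ : f ∈ᴸ E) {v} → v ∈ f → ℓ v ≡ start f∈ → v ≢ newTop f∈ → PathEdge f∈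
  top≢newTop⇒path f∈ v∈ v-top v≢newTop with PathEdge? f∈
  ... | yes path = path
  ... | no _     = ⊥-elim (v≢newTop (top-unique f∈ v∈ v-top))

  ¬newStart⇒≢newTop : ∀ {f} (f∈ : f ∈ᴸ E) {v} → ¬ LayerEdge k newLayer f (newLayer v) → v ≢ newTop f∈
  ¬newStart⇒≢newTop f∈ ¬at refl = ¬at (newLayer-edge f∈)

  -- An old top that is not the new top lies on the r–s path, and a lower vertex on the path is a new top.
  demoted-top-not-lower : ∀ {e e′} (e∈ : e ∈ᴸ E) (e′∈ : e′ ∈ᴸ E) {v} → v ∈ e → v ∈ e′ →
                          ℓ v ≡ start e∈ → v ≢ newTop e∈ → ℓ v ≢ start e′∈ → v ≢ newTop e′∈ → ⊥
  demoted-top-not-lower e∈ e′∈ v∈e v∈e′ v-top v≢newTop v-low′ v≢newTop′ = v≢newTop′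
    (lower∧onPath⇒newTop e′∈ v∈e′ v-low′
      (subst OnPath (sym (top-unique e∈ v∈e v-top)) (top-onPath e∈ (top≢newTop⇒path e∈ v∈e v-top v≢newTop))))

  newLayer-atMostOne : ∀ v {e e′} (e∈ : e ∈ᴸ E) (e′∈ : e′ ∈ᴸ E) → v ∈ e → v ∈ e′ →
                       ¬ LayerEdge k newLayer e (newLayer v) → ¬ LayerEdge k newLayer e′ (newLayer v) → e ≡ e′
  newLayer-atMostOne v {e} {e′} e∈ e′∈ v∈e v∈e′ ¬at ¬at′ with ℓ v ≟ start e∈ | ℓ v ≟ start e′∈
  ... | no v-low  | no v-low′  = lower-edge-unique e∈ e′∈ v∈e v∈e′ v-low v-low′
  ... | yes v-top | no v-low′  = ⊥-elim (demoted-top-not-lower e∈ e′∈ v∈e v∈e′ v-top v≢newTop v-low′ v≢newTop′)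
    where
    v≢newTop = ¬newStart⇒≢newTop e∈ ¬at
    v≢newTop′ = ¬newStart⇒≢newTop e′∈ ¬at′
  ... | no v-low  | yes v-top′ = ⊥-elim (demoted-top-not-lower e′∈ e∈ v∈e′ v∈e v-top′ v≢newTop′ v-low v≢newTop)
    where
    v≢newTop = ¬newStart⇒≢newTop e∈ ¬at
    v≢newTop′ = ¬newStart⇒≢newTop e′∈ ¬at′
  ... | yes v-top | yes v-top′ = lower-edge-unique e∈ e′∈ (proj₂ path) child∈e′ (pathChild-lower e∈ path) child-low′
    where
    path : PathEdge e∈
    path = top≢newTop⇒path e∈ v∈e v-top (¬newStart⇒≢newTop e∈ ¬at)
    path′ : PathEdge e′∈
    path′ = top≢newTop⇒path e′∈ v∈e′ v-top′ (¬newStart⇒≢newTop e′∈ ¬at′)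
    child≡ : pathChild e∈ ≡ pathChild e′∈
    child≡ = cong (λ z → ancestor (dₛ ∸ suc (depth z)) s)
                  (trans (sym (top-unique e∈ v∈e v-top)) (top-unique e′∈ v∈e′ v-top′))
    child∈e′ : pathChild e∈ ∈ e′
    child∈e′ = subst (_∈ _) (sym child≡) (proj₂ path′)
    child-low′ : ℓ (pathChild e∈) ≢ start e′∈
    child-low′ eq = pathChild-lower e′∈ path′ (trans (cong ℓ (sym child≡)) eq)

  open LayerColouring k′ newLayer newLayer≥1

  rerooted : RootedLooseTree k
  rerooted = record
    { tree      = G
    ; isTree    = isTree T
    ; root      = s
    ; colour    = colourOf
    ; proper    = λ e∈ v w v∈ w∈ → colourOf-proper (edge-size e∈) (newLayer-edge e∈) v∈ w∈
    ; layer     = newLayer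
    ; layer≥1   = newLayer≥1
    ; L₁≡root   = newLayer≡1⇒s
    ; rootL₁    = newLayer-s
    ; colLayer  = layer≡colour
    ; edgeLayer = λ e∈ → _ , newLayer-edge e∈
    ; atMostOne = newLayer-atMostOne
    }

  rotate-colour : ∀ w → rotate (toℕ (colour T s)) ⟨$⟩ʳ colourOf w ≡ colour T w
  rotate-colour w = toℕ-injective (begin
    toℕ (rotate (toℕ (colour T s)) ⟨$⟩ʳ colourOf w)     ≡⟨ toℕ-rotate (toℕ (colour T s)) (colourOf w) ⟩
    (toℕ (colourOf w) + toℕ (colour T s)) % k          ≡⟨ cong (λ z → (z + toℕ (colour T s)) % k) (toℕ-residue (newLayer w ∸ 1)) ⟩
    ((newLayer w ∸ 1) % k + toℕ (colour T s)) % k      ≡⟨ colour-shift {qw = proj₁ (colLayer T w)} {qs = proj₁ (colLayer T s)}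
                                                           (toℕ<n (colour T w)) layers
                                                           (proj₂ (colLayer T w)) (proj₂ (colLayer T s)) ⟩
    toℕ (colour T w)                                   ∎)
    where
    open ≡-Reasoning
    layers : (newLayer w ∸ 1) + ℓ s ≡ ℓ w + k * raise w
    layers = begin
      raised w ∸ (ℓ s ∸ 1) ∸ 1 + ℓ s     ≡⟨ cong (_+ ℓ s) (∸-+-assoc (raised w) (ℓ s ∸ 1) 1) ⟩
      raised w ∸ (ℓ s ∸ 1 + 1) + ℓ s     ≡⟨ cong (λ z → raised w ∸ z + ℓ s) (trans (+-comm _ 1) 1+[ℓs∸1]≡ℓs) ⟩
      raised w ∸ ℓ s + ℓ s               ≡⟨ m∸n+n≡m (proj₁ (bounded w)) ⟩
      raised w                           ∎

hom-cong : ∀ {k} (H₁ H₂ : KGraph k) (φ ψ : Fin (n H₁) → Fin (n H₂)) → IsHom H₁ H₂ φ →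
           ∀ {f} → f ∈ᴸ edges H₁ → (∀ w → w ∈ f → ψ w ≡ φ w) →
           ∃ λ g → g ∈ᴸ edges H₂ ×
             (∀ y → (y ∈ g → ∃ λ x → x ∈ f × ψ x ≡ y) × ((∃ λ x → x ∈ f × ψ x ≡ y) → y ∈ g))
hom-cong H₁ H₂ φ ψ hom f∈ ψ≡φ with hom f∈
... | g , g∈ , image = g , g∈ , λ y →
  (λ y∈ → case proj₁ (image y) y∈ of λ { (x , x∈ , φx≡y) → x , x∈ , trans (ψ≡φ x x∈) φx≡y }) ,
  (λ { (x , x∈ , ψx≡y) → proj₂ (image y) (x , x∈ , trans (sym (ψ≡φ x x∈)) ψx≡y) })

module Embedding {k′} (G : KGraph (suc k′)) (v : Fin (n G)) (e : Subset (n G)) (x : Fin (suc k′) → Fin (n G))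
                 (C C′ : ℕ) (reach : Reachable G C v e) (rot : Rotatable G C′ e x)
                 (T : RootedLooseTree (suc k′)) where

  open RootedTree k′ T renaming (G to Tree)

  φ₀ : V → Fin (n G)
  φ₀ = proj₁ (reach T)

  φ₀-hom : IsHom Tree G φ₀
  φ₀-hom = proj₁ (proj₂ (reach T))

  φ₀-root : φ₀ r ≡ v
  φ₀-root = proj₁ (proj₂ (proj₂ (reach T)))

  φ₀-deep : ∀ s → C < depth s → φ₀ s ∈ e
  φ₀-deep s C<s = proj₂ (proj₂ (proj₂ (reach T))) s (depth s) (dist-root s) C<s

  σ : V → Permutation′ (suc k′)
  σ s = Cyclic.rotate k′ (toℕ (colour T s))

  rotated : V → V → Fin (n G)
  rotated s with C <? depth s
  ... | yes C<s = proj₁ (rot (φ₀ s) (φ₀-deep s C<s) (σ s) (Reroot.rerooted k′ T s))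
  ... | no _    = φ₀

  InSubtreeOf : V → V → Set
  InSubtreeOf = Reroot.InSubtree k′ T

  rotated-spec : ∀ s → C < depth s → IsHom Tree G (rotated s) × rotated s s ≡ φ₀ s ×
                 (∀ w → InSubtreeOf s w → C′ ≤ depth w ∸ depth s → rotated s w ≡ x (colour T w))
  rotated-spec s C<s with C <? depth s
  ... | no C≮s = ⊥-elim (C≮s C<s)
  ... | yes C<s′ with rot (φ₀ s) (φ₀-deep s C<s′) (σ s) (Reroot.rerooted k′ T s)
  ... | φ , φ-hom , φs≡ , φ-far = φ-hom , φs≡ , far
    where
    far : ∀ w → InSubtreeOf s w → C′ ≤ depth w ∸ depth s → φ w ≡ x (colour T w)
    far w (s≤w , w↑≡s) C′≤ = trans
      (φ-far w (depth w ∸ depth s)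
        (subst (λ z → DistIs Tree z w (depth w ∸ depth s)) w↑≡s (dist-ancestor _ w (m∸n≤m (depth w) (depth s))))
        C′≤)
      (cong x (Reroot.rotate-colour k′ T s w))

  branch : V → V
  branch u = ancestor (depth u ∸ suc C) u

  depth-branch : ∀ u → suc C ≤ depth u → depth (branch u) ≡ suc C
  depth-branch u C<u = trans (depth-ancestor (depth u ∸ suc C) u) (m∸[m∸n]≡n C<u)

  branch-root : ∀ u → suc C ≤ depth u → InSubtreeOf (branch u) u
  branch-root u C<u = ≤-trans (≤-reflexive (depth-branch u C<u)) C<u ,
                      cong (λ z → ancestor (depth u ∸ z) u) (depth-branch u C<u)

  ψ : V → Fin (n G)
  ψ u with depth u ≤? suc C
  ... | yes _ = φ₀ u
  ... | no _  = rotated (branch u) u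

  ψ-shallow : ∀ u → depth u ≤ suc C → ψ u ≡ φ₀ u
  ψ-shallow u u≤ with depth u ≤? suc C
  ... | yes _  = refl
  ... | no u≰ = ⊥-elim (u≰ u≤)

  ψ-deep : ∀ u → suc C ≤ depth u → ψ u ≡ rotated (branch u) u
  ψ-deep u C<u with depth u ≤? suc C
  ... | no _   = refl
  ... | yes u≤ = trans (sym (proj₁ (proj₂ (rotated-spec u C<u))))
                       (cong (λ z → rotated z u) (sym branch≡u))
    where
    branch≡u : branch u ≡ u
    branch≡u = cong (λ z → ancestor z u) (trans (cong (_∸ suc C) (≤-antisym u≤ C<u)) (n∸n≡0 (suc C)))

  -- An edge either lies within depth C + 1, or all of its vertices have the same branch.
  ψ-hom : IsHom Tree G ψ
  ψ-hom {f} f∈ with depth (top f∈) ≤? C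
  ... | yes top≤C = hom-cong Tree G φ₀ ψ φ₀-hom f∈
                      (λ w w∈ → ψ-shallow w (≤-trans (depth≤1+depth-top f∈ w∈) (s≤s top≤C)))
  ... | no top≰C = hom-cong Tree G (rotated b) ψ (proj₁ (rotated-spec b C<b)) f∈ ψ≡rotated
    where
    t = top f∈
    C<t : suc C ≤ depth t
    C<t = ≰⇒> top≰C
    b = branch t
    C<b : C < depth b
    C<b = ≤-reflexive (sym (depth-branch t C<t))
    ψ≡rotated : ∀ w → w ∈ f → ψ w ≡ rotated b w
    ψ≡rotated w w∈ with top-or-lower f∈ w∈
    ... | inj₁ refl = ψ-deep t C<t
    ... | inj₂ (parent≡ , depth≡) = trans (ψ-deep w C<w) (cong (λ z → rotated z w) same-branch)
      where
      C<w : suc C ≤ depth w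
      C<w = ≤-trans C<t (≤-trans (n≤1+n _) (≤-reflexive (sym depth≡)))
      same-branch : branch w ≡ b
      same-branch = begin
        ancestor (depth w ∸ suc C) w             ≡⟨ cong (λ z → ancestor (z ∸ suc C) w) depth≡ ⟩
        ancestor (suc (depth t) ∸ suc C) w       ≡⟨ cong (λ z → ancestor z w) (+-∸-assoc 1 C<t) ⟩
        ancestor (suc (depth t ∸ suc C)) w       ≡⟨ ancestor-suc (depth t ∸ suc C) w ⟩
        ancestor (depth t ∸ suc C) (parent w)    ≡⟨ cong (ancestor (depth t ∸ suc C)) parent≡ ⟩
        b                                        ∎
        where open ≡-Reasoning

  ψ-root : ψ r ≡ v
  ψ-root = trans (ψ-shallow r (≤-trans (≤-reflexive depth-root) z≤n)) φ₀-root

  ψ-far : ∀ w → C + C′ < depth w → ψ w ≡ x (colour T w)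
  ψ-far w C+C′<w = trans (ψ-deep w C<w) (proj₂ (proj₂ (rotated-spec (branch w) C<b)) w (branch-root w C<w) C′≤)
    where
    C<w : suc C ≤ depth w
    C<w = ≤-trans (s≤s (m≤m+n C C′)) C+C′<w
    C<b : C < depth (branch w)
    C<b = ≤-reflexive (sym (depth-branch w C<w))
    C′≤ : C′ ≤ depth w ∸ depth (branch w)
    C′≤ = begin
      C′                         ≡⟨ m+n∸m≡n (suc C) C′ ⟨
      suc C + C′ ∸ suc C         ≤⟨ ∸-monoˡ-≤ (suc C) C+C′<w ⟩
      depth w ∸ suc C            ≡⟨ cong (depth w ∸_) (depth-branch w C<w) ⟨
      depth w ∸ depth (branch w) ∎
      where open ≤-Reasoning

  missCount≤∣ball∣ : ∀ j → missCount T ψ j x ≤ ∣ ball (C + C′) ∣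
  missCount≤∣ball∣ j = p⊆q⇒∣p∣≤∣q∣ (λ {w} w∈ → ∈-ball⁺ (missed⇒near w (∈-tabulate⁻ _ w∈)))
    where
    missed⇒near : ∀ w → ⌊ colour T w Fin.≟ j ⌋ ∧ not ⌊ ψ w Fin.≟ x j ⌋ ≡ true → depth w ≤ C + C′
    missed⇒near w missed with colour T w Fin.≟ j | ψ w Fin.≟ x j
    missed⇒near w ()     | no _     | _
    missed⇒near w ()     | yes _    | yes _
    ... | yes refl | no ψw≢xj = ≮⇒≥ (λ far → ψw≢xj (ψ-far w far))

-- For k = 0 there is no rooted tree, as its root would need a colour in Fin 0.
proposition4p4 : ∀ {k} (G : KGraph k) (v : Fin (n G)) (e : Subset (n G)) (x : Fin k → Fin (n G))
    (C C′ Δ : ℕ) → e ∈ᴸ edges G → Enumerates G e x →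
    Reachable G C v e → Rotatable G C′ e x →
    (T : RootedLooseTree k) → (∀ w → degree (tree T) w ≤ Δ) →
    ∃ λ (φ : Fin (n (tree T)) → Fin (n G)) →
      IsHom (tree T) G φ × φ (root T) ≡ v ×
      (∀ j → missCount T φ j x ≤ (k * Δ) ^ (C + C′))
proposition4p4 {zero} G v e x C C′ Δ _ _ _ _ T _ with colour T (root T)
... | ()
proposition4p4 {suc k′} G v e x C C′ Δ _ _ reach rot T deg≤Δ =
  ψ , ψ-hom , ψ-root , λ j → ≤-trans (missCount≤∣ball∣ j) (RootedTree.∣ball∣≤ k′ T deg≤Δ (C + C′))
  where open Embedding G v e x C C′ reach rot T
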